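{- For $1\le k\le n$, let $f(n,k)$ denote the number of standard Young tableaux with $n$ cells and more than one column whose entry in position $(1,2)$ (first row, second column) equals $k$. Then \[f(n,k)=\sum_{j=0}^{k-1}\binom{n-k}{k-j-1}t_{n-2k+j+2}-\binom{n-k}{k-1}t_{n-2k+1}-\binom{n-k}{k}t_{n-2k},\] where $t_m$ denotes the number of involutions of $\{1,\dots,m\}$ (equivalently the number of standard Young tableaux with $m$ cells), with $t_0=1$.
   Context: Conventions: binomial coefficients $\binom{a}{b}$ with $b<0$ or $b>a$ are $0$; $t_m=0$ for $m<0$ (such terms only appear with vanishing binomial coefficient). -}

module Defs where

open import Data.Nat using (ℕ; zero; suc; _<_; _≤_; _∸_)
open import Data.Nat.Combinatorics using (_C_)
open import Data.Integer as ℤ using (ℤ; +_; -[1+_])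
open import Data.List using (List; []; _∷_; length; concat; map; upTo; foldr)
open import Data.List.Relation.Unary.All using (All)
open import Data.List.Relation.Unary.Linked using (Linked)
open import Data.List.Relation.Unary.Unique.Propositional using (Unique)
open import Data.List.Relation.Binary.Permutation.Propositional using (_↭_)
open import Data.List.Membership.Propositional using (_∈_)
open import Data.Vec using (Vec; lookup)
open import Data.Fin using (Fin)
open import Data.Product using (Σ; _×_; ∃)
open import Data.Unit using (⊤)
open import Data.Empty using (⊥)
open import Function.Bundles using (_⇔_)
open import Relation.Binary.PropositionalEquality using (_≡_)
open import Level using (Level)

-- "c is the number of elements x : A with P x":
-- there is a duplicate-free list whose members are exactly those x, of length c.
Counts : {a p : Level} {A : Set a} → (A → Set p) → ℕ → Set _
Counts {A = A} P c =
  Σ (List A) λ L → Unique L × (∀ x → (x ∈ L) ⇔ P x) × length L ≡ c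

IsInvolution : (m : ℕ) → Vec (Fin m) m → Set
IsInvolution m σ = ∀ i → lookup σ (lookup σ i) ≡ i

-- Standard Young tableaux (English convention), represented as the list
-- of their rows (top row first), each row the list of its entries
-- from left to right.

ColsBelow : List ℕ → List ℕ → Set
ColsBelow _ [] = ⊤
ColsBelow [] (_ ∷ _) = ⊥
ColsBelow (x ∷ xs) (y ∷ ys) = x < y × ColsBelow xs ys

NonEmpty : List ℕ → Set
NonEmpty [] = ⊥
NonEmpty (_ ∷ _) = ⊤

RowsRel : List ℕ → List ℕ → Set
RowsRel r r′ = length r′ ≤ length r × ColsBelow r r′

IsSYT : ℕ → List (List ℕ) → Set
IsSYT n T =
  All NonEmpty T ×
  Linked RowsRel T ×
  All (Linked _<_) T ×
  (concat T ↭ map suc (upTo n))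

Entry12 : List (List ℕ) → ℕ → Set
Entry12 T k = ∃ λ x → ∃ λ rest → ∃ λ rows → T ≡ (x ∷ k ∷ rest) ∷ rows

CountedByF : ℕ → ℕ → List (List ℕ) → Set
CountedByF n k T = IsSYT n T × Entry12 T k

-- t extended by 0 to negative indices
tℤ : (ℕ → ℕ) → ℤ → ℤ
tℤ t (+ m) = + (t m)
tℤ t -[1+ _ ] = + 0

-- binomial coefficient as an integer (n C b = 0 for b > n)
Cℤ : ℕ → ℕ → ℤ
Cℤ a b = + (a C b)

sumTo : ℕ → (ℕ → ℤ) → ℤ
sumTo k g = foldr ℤ._+_ (+ 0) (map g (upTo k))

RHS : (ℕ → ℕ) → ℕ → ℕ → ℤ
RHS t n k =
  sumTo k (λ j → Cℤ (n ∸ k) (k ∸ j ∸ 1)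
                  ℤ.* tℤ t (+ n ℤ.- + (2 Data.Nat.* k) ℤ.+ + j ℤ.+ + 2))
  ℤ.- Cℤ (n ∸ k) (k ∸ 1) ℤ.* tℤ t (+ n ℤ.- + (2 Data.Nat.* k) ℤ.+ + 1)
  ℤ.- Cℤ (n ∸ k) k ℤ.* tℤ t (+ n ℤ.- + (2 Data.Nat.* k))

module Submission where

-- Fill a standard Young tableau by placing 1, 2, …, n one at a time at outer
-- corners. If the (1,2) entry is k, then 1, …, k−1 fill the first column, so
-- f(n,k) = 0 for k = 1, and for k ≥ 2 the tableaux counted by f(n,k) are the
-- ways of growing the hook (2,1^{k−2}) by n−k further cells.
--
-- The commutation relation DU = UD + I of Young's lattice shows that the number
-- of ways to grow a shape μ by m cells is Σ_i d_i(μ) C(m,i) t_{m−i}, where d_i(μ)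
-- counts the ways to remove i cells from μ one at a time; the telephone numbers
-- t enter through t_{r+1} = t_r + r t_{r−1}. For the hook, d_i = min(i, k−2) + 1
-- for i ≤ k and d_i = 0 beyond, and the identity
-- C(m,i) t_{m+1−i} = C(m,i) t_{m−i} + (i+1) C(m,i+1) t_{m−i−1}
-- rewrites the resulting sum as the stated formula.

open import Defs
open import Level using (Level)
open import Function.Base using (_∘_)
open import Function.Bundles using (_⇔_; mk⇔; Equivalence)
open import Data.Empty using (⊥-elim)
open import Data.Unit using (⊤; tt)
open import Data.Bool using (Bool; true; false; T; if_then_else_)
open import Data.Product using (Σ; _×_; _,_; proj₁; proj₂)
open import Data.Sum using (_⊎_; inj₁; inj₂; [_,_]′)
open import Data.Sum.Properties using (inj₁-injective; inj₂-injective)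
open import Data.Nat using (ℕ; zero; suc; pred; _+_; _*_; _∸_; _⊓_; _≤_; _<_; z≤n; s≤s; _<ᵇ_; _≡ᵇ_; _≤?_; _≟_)
open import Data.Nat.Properties
open import Data.Nat.Combinatorics using (_C_; nC1≡n; nCk+nC[k+1]≡[n+1]C[k+1]; k>n⇒nCk≡0)
open import Data.Nat.Solver using (module +-*-Solver)
open import Algebra.Properties.CommutativeSemigroup +-commutativeSemigroup using () renaming (interchange to +-interchange)
open import Data.Fin as Fin using (Fin; zero; suc; punchIn; punchOut; pinch)
open import Data.Fin.Properties as Finₚ using (punchIn-punchOut; punchOut-punchIn; punchInᵢ≢i; punchOut-cong)
open import Data.Vec using (Vec; []; _∷_; lookup; tabulate)
open import Data.Vec.Properties using (lookup∘tabulate; tabulate∘lookup; tabulate-cong)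
open import Data.List using (List; []; _∷_; _++_; length; map; concat; concatMap; upTo; applyUpTo; replicate; filter; foldr)
open import Data.List.Properties using (∷-injectiveʳ; length-map; length-++; length-++-sucʳ; ++-identityʳ; ++-assoc; map-++; map-∘; upTo-∷ʳ)
open import Data.List.Relation.Unary.All as All using (All; []; _∷_)
import Data.List.Relation.Unary.All.Properties as Allₚ
open import Data.List.Relation.Unary.AllPairs using (AllPairs; []; _∷_)
import Data.List.Relation.Unary.AllPairs.Properties as AllPairsₚ
open import Data.List.Relation.Unary.Any using (here; there)
open import Data.List.Relation.Unary.Linked as Linked using (Linked; []; [-]; _∷_)
open import Data.List.Relation.Unary.Unique.Propositional using (Unique)
import Data.List.Relation.Unary.Unique.Propositional.Properties as Unique
open import Data.List.Membership.Propositional using (_∈_; _∉_)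
open import Data.List.Membership.Propositional.Properties
  using (∈-map⁺; ∈-map⁻; ∈-++⁺ˡ; ∈-++⁺ʳ; ∈-++⁻; ∈-upTo⁻; ∈-upTo⁺; ∈-concat⁺′; ∈-concat⁻′; ∈-filter⁺; ∈-filter⁻)
open import Data.List.Membership.Propositional.Properties.WithK using (unique∧set⇒bag)
open import Data.List.Membership.DecPropositional _≟_ using (_∈?_)
open import Data.List.Relation.Binary.BagAndSetEquality using (∼bag⇒↭)
open import Data.List.Relation.Binary.Permutation.Propositional using (_↭_; ↭-refl; ↭-sym; ↭-trans; prep; ↭⇒↭ₛ)
open import Data.List.Relation.Binary.Permutation.Propositional.Properties
  using (↭-length; shift; ++⁺ˡ; ∈-resp-↭; drop-∷; ↭-empty-inv)
import Data.List.Relation.Binary.Permutation.Setoid.Properties as Permₛ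
open import Relation.Nullary using (¬_; yes; no; Dec; does)
open import Relation.Nullary.Decidable using (map′)
open import Relation.Unary using (Decidable)
open import Relation.Binary.PropositionalEquality

∑ : {A : Set} → List A → (A → ℕ) → ℕ
∑ []       f = 0
∑ (x ∷ xs) f = f x + ∑ xs f

syntax ∑ xs (λ x → e) = ∑[ x ∈ xs ] e

∑< : ℕ → (ℕ → ℕ) → ℕ
∑< zero    g = 0
∑< (suc N) g = g 0 + ∑< N (g ∘ suc)

syntax ∑< N (λ i → e) = ∑[ i < N ] e

module _ {A : Set} where

  ∑-++ : ∀ (xs ys : List A) f → ∑ (xs ++ ys) f ≡ ∑ xs f + ∑ ys f
  ∑-++ []       ys f = refl
  ∑-++ (x ∷ xs) ys f = trans (cong (f x +_) (∑-++ xs ys f)) (sym (+-assoc (f x) _ _))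

  ∑-map : ∀ {B : Set} (g : A → B) (xs : List A) f → ∑ (map g xs) f ≡ ∑ xs (f ∘ g)
  ∑-map g []       f = refl
  ∑-map g (x ∷ xs) f = cong (f (g x) +_) (∑-map g xs f)

  ∑-cong-local : ∀ {P : A → Set} {f g : A → ℕ} {xs} → All P xs → (∀ {x} → P x → f x ≡ g x) → ∑ xs f ≡ ∑ xs g
  ∑-cong-local []         f≡g = refl
  ∑-cong-local (px ∷ pxs) f≡g = cong₂ _+_ (f≡g px) (∑-cong-local pxs f≡g)

  ∑-cong : ∀ {f g : A → ℕ} xs → (∀ x → f x ≡ g x) → ∑ xs f ≡ ∑ xs g
  ∑-cong []       f≡g = refl
  ∑-cong (x ∷ xs) f≡g = cong₂ _+_ (f≡g x) (∑-cong xs f≡g)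

  ∑-zero : ∀ (xs : List A) → ∑[ x ∈ xs ] 0 ≡ 0
  ∑-zero []       = refl
  ∑-zero (x ∷ xs) = ∑-zero xs

  ∑-distrib-+ : ∀ (xs : List A) f g → ∑[ x ∈ xs ] (f x + g x) ≡ ∑ xs f + ∑ xs g
  ∑-distrib-+ []       f g = refl
  ∑-distrib-+ (x ∷ xs) f g rewrite ∑-distrib-+ xs f g = +-interchange (f x) (g x) (∑ xs f) (∑ xs g)

  ∑-*ˡ : ∀ (xs : List A) w f → ∑[ x ∈ xs ] (w * f x) ≡ w * ∑ xs f
  ∑-*ˡ []       w f = sym (*-zeroʳ w)
  ∑-*ˡ (x ∷ xs) w f = trans (cong (w * f x +_) (∑-*ˡ xs w f)) (sym (*-distribˡ-+ w (f x) (∑ xs f)))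

  ∑-*ʳ : ∀ (xs : List A) w f → ∑[ x ∈ xs ] (f x * w) ≡ ∑ xs f * w
  ∑-*ʳ xs w f = trans (∑-cong xs (λ x → *-comm (f x) w)) (trans (∑-*ˡ xs w f) (*-comm w (∑ xs f)))

∑<-cong : ∀ N {f g : ℕ → ℕ} → (∀ i → i < N → f i ≡ g i) → ∑< N f ≡ ∑< N g
∑<-cong zero    f≡g = refl
∑<-cong (suc N) f≡g = cong₂ _+_ (f≡g 0 (s≤s z≤n)) (∑<-cong N (λ i i<N → f≡g (suc i) (s≤s i<N)))

∑<-zero : ∀ N → ∑[ i < N ] 0 ≡ 0
∑<-zero zero    = refl
∑<-zero (suc N) = ∑<-zero N

∑<-distrib-+ : ∀ N f g → ∑[ i < N ] (f i + g i) ≡ ∑< N f + ∑< N g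
∑<-distrib-+ zero    f g = refl
∑<-distrib-+ (suc N) f g rewrite ∑<-distrib-+ N (f ∘ suc) (g ∘ suc) =
  +-interchange (f 0) (g 0) (∑< N (f ∘ suc)) (∑< N (g ∘ suc))

∑<-suc : ∀ N f → ∑< (suc N) f ≡ ∑< N f + f N
∑<-suc zero    f = +-identityʳ (f 0)
∑<-suc (suc N) f rewrite ∑<-suc N (f ∘ suc) = sym (+-assoc (f 0) _ _)

∑<-pad : ∀ N d f → (∀ i → N ≤ i → f i ≡ 0) → ∑< (N + d) f ≡ ∑< N f
∑<-pad N zero    f f≡0 rewrite +-identityʳ N = refl
∑<-pad N (suc d) f f≡0 rewrite +-suc N d =
  trans (∑<-suc (N + d) f) (trans (cong₂ _+_ (∑<-pad N d f f≡0) (f≡0 (N + d) (m≤m+n N d))) (+-identityʳ _))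

∑<-reverse : ∀ k (h : ℕ → ℕ) → ∑[ j < k ] h (k ∸ suc j) ≡ ∑< k h
∑<-reverse zero    h = refl
∑<-reverse (suc k) h = begin
    h k + ∑[ j < k ] h (k ∸ suc j)  ≡⟨ cong (h k +_) (∑<-reverse k h) ⟩
    h k + ∑< k h                     ≡⟨ +-comm (h k) _ ⟩
    ∑< k h + h k                     ≡⟨ sym (∑<-suc k h) ⟩
    ∑< (suc k) h                     ∎
  where open ≡-Reasoning

∑-∑<-comm : {A : Set} (xs : List A) (N : ℕ) (F : A → ℕ → ℕ) → ∑[ x ∈ xs ] ∑< N (F x) ≡ ∑[ i < N ] ∑[ x ∈ xs ] F x i
∑-∑<-comm []       N F = sym (∑<-zero N)
∑-∑<-comm (x ∷ xs) N F = trans (cong (∑< N (F x) +_) (∑-∑<-comm xs N F)) (sym (∑<-distrib-+ N (F x) _))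

singletonIf : {A : Set} → Bool → A → List A
singletonIf true  x = x ∷ []
singletonIf false x = []

∑-singletonIf-const : {A : Set} (b : Bool) (x y : A) (c : ℕ) → ∑ (singletonIf b x) (λ _ → c) ≡ ∑ (singletonIf b y) (λ _ → c)
∑-singletonIf-const true  x y c = refl
∑-singletonIf-const false x y c = refl

∑-singletonIf-map : {A B : Set} (b : Bool) (g : A → B) (x : A) (f : B → ℕ) → ∑ (singletonIf b (g x)) f ≡ ∑ (singletonIf b x) (f ∘ g)
∑-singletonIf-map true  g x f = refl
∑-singletonIf-map false g x f = refl

All-singletonIf : {A : Set} {P : A → Set} (b : Bool) {x : A} → (T b → P x) → All P (singletonIf b x)
All-singletonIf true  px = px tt ∷ []
All-singletonIf false px = []

map-singletonIf : {A B : Set} (f : A → B) (b : Bool) (x : A) → map f (singletonIf b x) ≡ singletonIf b (f x)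
map-singletonIf f true  x = refl
map-singletonIf f false x = refl

∈-singletonIf : {A : Set} {y x : A} (b : Bool) → y ∈ singletonIf b x → y ≡ x × T b
∈-singletonIf true (here y≡x) = y≡x , tt

Unique-singletonIf : {A : Set} (b : Bool) (x : A) → Unique (singletonIf b x)
Unique-singletonIf true  x = [] ∷ []
Unique-singletonIf false x = []

∑-concatMap : {A B : Set} (f : A → List B) (xs : List A) (φ : B → ℕ) → ∑ (concatMap f xs) φ ≡ ∑[ x ∈ xs ] ∑ (f x) φ
∑-concatMap f []       φ = refl
∑-concatMap f (x ∷ xs) φ = trans (∑-++ (f x) (concatMap f xs) φ) (cong (∑ (f x) φ +_) (∑-concatMap f xs φ))

∑<-shift : ∀ N f → f N ≡ 0 → ∑< N f ≡ f 0 + ∑< N (f ∘ suc)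
∑<-shift N f fN≡0 = begin
  ∑< N f               ≡⟨ sym (+-identityʳ _) ⟩
  ∑< N f + 0           ≡⟨ cong (∑< N f +_) (sym fN≡0) ⟩
  ∑< N f + f N         ≡⟨ sym (∑<-suc N f) ⟩
  ∑< (suc N) f         ∎
  where open ≡-Reasoning

length-filter : {A : Set} {P : A → Set} (P? : Decidable P) (xs : List A) →
  length (filter P? xs) ≡ ∑[ x ∈ xs ] (if does (P? x) then 1 else 0)
length-filter P? []       = refl
length-filter P? (x ∷ xs) with does (P? x)
... | true  = cong suc (length-filter P? xs)
... | false = length-filter P? xs

module _ {a p : Level} {A : Set a} {P : A → Set p} where

  Counts-unique : ∀ {m n} → Counts P m → Counts P n → m ≡ n
  Counts-unique (xs , xs! , xs⇔P , refl) (ys , ys! , ys⇔P , refl) =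
    ↭-length (∼bag⇒↭ (unique∧set⇒bag xs! ys! (λ {x} →
      mk⇔ (Equivalence.from (ys⇔P x) ∘ Equivalence.to (xs⇔P x))
          (Equivalence.from (xs⇔P x) ∘ Equivalence.to (ys⇔P x)))))

  module _ {b q : Level} {B : Set b} {Q : B → Set q} where

    Counts-map : (f : B → A) (g : A → B) → (∀ y → g (f y) ≡ y) →
      (∀ {y} → Q y → P (f y)) → (∀ {x} → P x → Q (g x)) → (∀ {x} → P x → f (g x) ≡ x) →
      ∀ {c} → Counts Q c → Counts P c
    Counts-map f g g∘f Q⇒P P⇒Q f∘g (ys , ys! , ys⇔Q , refl) =
      map f ys , Unique.map⁺ f-injective ys! , f[ys]⇔P , length-map f ys
      where
      f-injective : ∀ {x y} → f x ≡ f y → x ≡ y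
      f-injective {x} {y} fx≡fy = trans (sym (g∘f x)) (trans (cong g fx≡fy) (g∘f y))
      f[ys]⇔P : ∀ x → (x ∈ map f ys) ⇔ P x
      f[ys]⇔P x = mk⇔ to from
        where
        to : x ∈ map f ys → P x
        to x∈f[ys] with ∈-map⁻ f x∈f[ys]
        ... | y , y∈ys , refl = Q⇒P (Equivalence.to (ys⇔Q y) y∈ys)
        from : P x → x ∈ map f ys
        from px = subst (_∈ map f ys) (f∘g px) (∈-map⁺ f (Equivalence.from (ys⇔Q (g x)) (P⇒Q px)))

module _ {A B : Set} {P : A → Set} {Q : B → Set} where

  Counts-⊎ : ∀ {c d} → Counts P c → Counts Q d → Counts [ P , Q ]′ (c + d)
  Counts-⊎ (xs , xs! , xs⇔P , refl) (ys , ys! , ys⇔Q , refl) =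
    map inj₁ xs ++ map inj₂ ys ,
    Unique.++⁺ (Unique.map⁺ inj₁-injective xs!) (Unique.map⁺ inj₂-injective ys!) disjoint ,
    members ,
    trans (length-++ (map inj₁ xs)) (cong₂ _+_ (length-map inj₁ xs) (length-map inj₂ ys))
    where
    disjoint : ∀ {v} → ¬ (v ∈ map inj₁ xs × v ∈ map inj₂ ys)
    disjoint (v∈₁ , v∈₂) with ∈-map⁻ inj₁ v∈₁ | ∈-map⁻ inj₂ v∈₂
    ... | _ , _ , refl | _ , _ , ()
    members : ∀ v → (v ∈ map inj₁ xs ++ map inj₂ ys) ⇔ [ P , Q ]′ v
    members v = mk⇔ (to v) (from v)
      where
      to : ∀ v → v ∈ map inj₁ xs ++ map inj₂ ys → [ P , Q ]′ v
      to v v∈ with ∈-++⁻ (map inj₁ xs) v∈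
      ... | inj₁ v∈₁ with ∈-map⁻ inj₁ v∈₁
      ...   | x , x∈xs , refl = Equivalence.to (xs⇔P x) x∈xs
      to v v∈ | inj₂ v∈₂ with ∈-map⁻ inj₂ v∈₂
      ...   | y , y∈ys , refl = Equivalence.to (ys⇔Q y) y∈ys
      from : ∀ v → [ P , Q ]′ v → v ∈ map inj₁ xs ++ map inj₂ ys
      from (inj₁ x) px = ∈-++⁺ˡ (∈-map⁺ inj₁ (Equivalence.from (xs⇔P x) px))
      from (inj₂ y) qy = ∈-++⁺ʳ (map inj₁ xs) (∈-map⁺ inj₂ (Equivalence.from (ys⇔Q y) qy))

module _ {A : Set} {P : A → Set} where

  Counts-Fin× : ∀ k {c} → Counts P c → Counts {A = Fin k × A} (P ∘ proj₂) (k * c)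
  Counts-Fin× zero    _  = [] , [] , (λ { (() , _) }) , refl
  Counts-Fin× (suc k) cP = Counts-map into outof (λ { (inj₁ _) → refl ; (inj₂ _) → refl })
    (λ { {inj₁ _} p → p ; {inj₂ _} p → p }) (λ { {zero , _} p → p ; {suc _ , _} p → p })
    (λ { {zero , _} _ → refl ; {suc _ , _} _ → refl })
    (Counts-⊎ cP (Counts-Fin× k cP))
    where
    into : A ⊎ (Fin k × A) → Fin (suc k) × A
    into (inj₁ x)       = zero , x
    into (inj₂ (j , x)) = suc j , x
    outof : Fin (suc k) × A → A ⊎ (Fin k × A)
    outof (zero  , x) = inj₁ x
    outof (suc j , x) = inj₂ (j , x)

-- Involutions

telephone : ℕ → ℕ
telephone 0             = 1
telephone 1             = 1
telephone (suc (suc m)) = telephone (suc m) + suc m * telephone m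

Involutive : ∀ {n} → (Fin n → Fin n) → Set
Involutive s = ∀ i → s (s i) ≡ i

module _ {n : ℕ} where

  fix₀ : (Fin n → Fin n) → Fin (suc n) → Fin (suc n)
  fix₀ s zero    = zero
  fix₀ s (suc i) = suc (s i)

  fix₀-involutive : ∀ s → Involutive s → Involutive (fix₀ s)
  fix₀-involutive s s-inv zero    = refl
  fix₀-involutive s s-inv (suc i) = cong suc (s-inv i)

  punchOutOr : Fin n → Fin (suc n) → Fin (suc n) → Fin n
  punchOutOr d i j with i Fin.≟ j
  ... | yes _   = d
  ... | no i≢j = punchOut i≢j

  punchOutOr-punchIn : ∀ d i j → punchOutOr d i (punchIn i j) ≡ j
  punchOutOr-punchIn d i j with i Fin.≟ punchIn i j
  ... | yes i≡ = ⊥-elim (punchInᵢ≢i i j (sym i≡))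
  ... | no _   = trans (punchOut-cong i refl) (punchOut-punchIn i)

  punchIn-punchOutOr : ∀ d i j → i ≢ j → punchIn i (punchOutOr d i j) ≡ j
  punchIn-punchOutOr d i j i≢j with i Fin.≟ j
  ... | yes i≡j = ⊥-elim (i≢j i≡j)
  ... | no i≢j  = punchIn-punchOut i≢j

module _ {m : ℕ} where

  swap₀ : Fin (suc m) → (Fin m → Fin m) → Fin (suc (suc m)) → Fin (suc (suc m))
  swap₀ j s zero = suc j
  swap₀ j s (suc i) with j Fin.≟ i
  ... | yes _   = zero
  ... | no j≢i = suc (punchIn j (s (punchOut j≢i)))

  swap₀-partner : ∀ j s → swap₀ j s (suc j) ≡ zero
  swap₀-partner j s with j Fin.≟ j
  ... | yes _   = refl
  ... | no j≢j = ⊥-elim (j≢j refl)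

  swap₀-punchIn : ∀ j s i → swap₀ j s (suc (punchIn j i)) ≡ suc (punchIn j (s i))
  swap₀-punchIn j s i with j Fin.≟ punchIn j i
  ... | yes j≡ = ⊥-elim (punchInᵢ≢i j i (sym j≡))
  ... | no _   = cong (suc ∘ punchIn j ∘ s) (trans (punchOut-cong j refl) (punchOut-punchIn j))

  swap₀-involutive : ∀ j s → Involutive s → Involutive (swap₀ j s)
  swap₀-involutive j s s-inv zero = swap₀-partner j s
  swap₀-involutive j s s-inv (suc i) with j Fin.≟ i
  ... | yes refl = refl
  ... | no j≢i   = trans (swap₀-punchIn j s (s (punchOut j≢i)))
                         (cong suc (trans (cong (punchIn j) (s-inv (punchOut j≢i))) (punchIn-punchOut j≢i)))

  unfix₀ : (Fin (suc (suc m)) → Fin (suc (suc m))) → Fin (suc m) → Fin (suc m)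
  unfix₀ σ i = pinch zero (σ (suc i))

  unswap₀ : Fin (suc m) → (Fin (suc (suc m)) → Fin (suc (suc m))) → Fin m → Fin m
  unswap₀ j σ i = punchOutOr i j (pinch zero (σ (suc (punchIn j i))))

  suc-pinch₀ : ∀ {y : Fin (suc (suc m))} → y ≢ zero → suc (pinch zero y) ≡ y
  suc-pinch₀ {zero}  y≢0 = ⊥-elim (y≢0 refl)
  suc-pinch₀ {suc _} _   = refl

  module _ {σ : Fin (suc (suc m)) → Fin (suc (suc m))} (σ-inv : Involutive σ) where

    unfix₀-correct : σ zero ≡ zero → ∀ i → suc (unfix₀ σ i) ≡ σ (suc i)
    unfix₀-correct σ0≡0 i = suc-pinch₀ σ≢0
      where
      σ≢0 : σ (suc i) ≢ zero
      σ≢0 σi≡0 with trans (sym (σ-inv (suc i))) (trans (cong σ σi≡0) σ0≡0)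
      ... | ()

    unswap₀-correct : ∀ j → σ zero ≡ suc j → ∀ i → suc (punchIn j (unswap₀ j σ i)) ≡ σ (suc (punchIn j i))
    unswap₀-correct j σ0≡j i = trans (cong suc (punchIn-punchOutOr i j _ j≢)) σx-nonzero
      where
      x = suc (punchIn j i)
      σx≢0 : σ x ≢ zero
      σx≢0 σx≡0 = punchInᵢ≢i j i (Finₚ.suc-injective (trans (sym (σ-inv x)) (trans (cong σ σx≡0) σ0≡j)))
      σx-nonzero : suc (pinch zero (σ x)) ≡ σ x
      σx-nonzero = suc-pinch₀ σx≢0
      j≢ : j ≢ pinch zero (σ x)
      j≢ j≡ with trans (sym (σ-inv zero)) (cong σ (trans σ0≡j (trans (cong suc j≡) σx-nonzero)))
      ... | 0≡x with trans 0≡x (σ-inv x)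
      ...   | ()

tabulate-lookup : ∀ {A : Set} {n} {f : Fin n → A} {v : Vec A n} → (∀ i → f i ≡ lookup v i) → tabulate f ≡ v
tabulate-lookup {v = v} f≗v = trans (tabulate-cong f≗v) (tabulate∘lookup v)

IsInvolution-tabulate : ∀ {n} (s : Fin n → Fin n) → Involutive s → IsInvolution n (tabulate s)
IsInvolution-tabulate s s-inv i =
  trans (lookup∘tabulate s _) (trans (cong s (lookup∘tabulate s i)) (s-inv i))

module _ {m : ℕ} where

  private
    Inv : ℕ → Set
    Inv n = Vec (Fin n) n

    Smaller : Set
    Smaller = Inv (suc m) ⊎ (Fin (suc m) × Inv m)

    IsSmaller : Smaller → Set
    IsSmaller = [ IsInvolution (suc m) , IsInvolution m ∘ proj₂ ]′

  -- An involution of {0, …, m+1} fixes 0 or exchanges it with some j+1; removing 0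
  -- (and its partner) gives t(m+2) = t(m+1) + (m+1) t(m).
  insert₀ : Smaller → Inv (suc (suc m))
  insert₀ (inj₁ σ)       = tabulate (fix₀ (lookup σ))
  insert₀ (inj₂ (j , τ)) = tabulate (swap₀ j (lookup τ))

  delete₀At : Inv (suc (suc m)) → Fin (suc (suc m)) → Smaller
  delete₀At σ zero    = inj₁ (tabulate (unfix₀ (lookup σ)))
  delete₀At σ (suc j) = inj₂ (j , tabulate (unswap₀ j (lookup σ)))

  delete₀ : Inv (suc (suc m)) → Smaller
  delete₀ σ = delete₀At σ (lookup σ zero)

  delete₀∘insert₀ : ∀ x → delete₀ (insert₀ x) ≡ x
  delete₀∘insert₀ (inj₁ σ) = cong inj₁ (tabulate-lookup λ i →
    cong (pinch zero) (lookup∘tabulate (fix₀ (lookup σ)) (suc i)))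
  delete₀∘insert₀ (inj₂ (j , τ)) = cong (inj₂ ∘ (j ,_)) (tabulate-lookup λ i → begin
      punchOutOr i j (pinch zero (lookup (tabulate (swap₀ j (lookup τ))) (suc (punchIn j i))))
    ≡⟨ cong (punchOutOr i j ∘ pinch zero) (lookup∘tabulate (swap₀ j (lookup τ)) (suc (punchIn j i))) ⟩
      punchOutOr i j (pinch zero (swap₀ j (lookup τ) (suc (punchIn j i))))
    ≡⟨ cong (punchOutOr i j ∘ pinch zero) (swap₀-punchIn j (lookup τ) i) ⟩
      punchOutOr i j (punchIn j (lookup τ i))
    ≡⟨ punchOutOr-punchIn i j (lookup τ i) ⟩
      lookup τ i
    ∎)
    where open ≡-Reasoning

  IsInvolution-insert₀ : ∀ {x} → IsSmaller x → IsInvolution (suc (suc m)) (insert₀ x)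
  IsInvolution-insert₀ {inj₁ σ}       σ-inv = IsInvolution-tabulate (fix₀ (lookup σ)) (fix₀-involutive (lookup σ) σ-inv)
  IsInvolution-insert₀ {inj₂ (j , τ)} τ-inv = IsInvolution-tabulate (swap₀ j (lookup τ)) (swap₀-involutive j (lookup τ) τ-inv)

  module _ {σ : Inv (suc (suc m))} (σ-inv : IsInvolution (suc (suc m)) σ) where

    IsInvolution-delete₀ : IsSmaller (delete₀ σ)
    IsInvolution-delete₀ with lookup σ zero in σ0
    ... | zero  = IsInvolution-tabulate (unfix₀ (lookup σ)) λ i → Finₚ.suc-injective (begin
          suc (unfix₀ (lookup σ) (unfix₀ (lookup σ) i))
            ≡⟨ unfix₀-correct {σ = lookup σ} σ-inv σ0 _ ⟩
          lookup σ (suc (unfix₀ (lookup σ) i))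
            ≡⟨ cong (lookup σ) (unfix₀-correct {σ = lookup σ} σ-inv σ0 i) ⟩
          lookup σ (lookup σ (suc i))
            ≡⟨ σ-inv (suc i) ⟩
          suc i ∎)
      where open ≡-Reasoning
    ... | suc j = IsInvolution-tabulate (unswap₀ j (lookup σ)) unswap₀-involutive
      where
      open ≡-Reasoning
      unswap₀-involutive : Involutive (unswap₀ j (lookup σ))
      unswap₀-involutive i = begin
          punchOutOr τi j (pinch zero (lookup σ (suc (punchIn j τi))))
            ≡⟨ cong (punchOutOr τi j ∘ pinch zero ∘ lookup σ) (unswap₀-correct {σ = lookup σ} σ-inv j σ0 i) ⟩
          punchOutOr τi j (pinch zero (lookup σ (lookup σ (suc (punchIn j i)))))
            ≡⟨ cong (punchOutOr τi j ∘ pinch zero) (σ-inv (suc (punchIn j i))) ⟩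
          punchOutOr τi j (punchIn j i)
            ≡⟨ punchOutOr-punchIn τi j i ⟩
          i ∎
        where τi = unswap₀ j (lookup σ) i

    insert₀∘delete₀ : insert₀ (delete₀ σ) ≡ σ
    insert₀∘delete₀ with lookup σ zero in σ0
    ... | zero  = tabulate-lookup {f = fix₀ (lookup (tabulate (unfix₀ (lookup σ))))} λ where
          zero    → sym σ0
          (suc i) → trans (cong suc (lookup∘tabulate (unfix₀ (lookup σ)) i)) (unfix₀-correct {σ = lookup σ} σ-inv σ0 i)
    ... | suc j = tabulate-lookup {f = swap₀ j (lookup τ)} λ where
          zero    → sym σ0
          (suc i) → agrees i
      where
      τ = tabulate (unswap₀ j (lookup σ))
      agrees : ∀ i → swap₀ j (lookup τ) (suc i) ≡ lookup σ (suc i)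
      agrees i with j Fin.≟ i
      ... | yes refl = sym (trans (cong (lookup σ) (sym σ0)) (σ-inv zero))
      ... | no j≢i  = begin
            suc (punchIn j (lookup τ (punchOut j≢i)))
              ≡⟨ cong (suc ∘ punchIn j) (lookup∘tabulate (unswap₀ j (lookup σ)) (punchOut j≢i)) ⟩
            suc (punchIn j (unswap₀ j (lookup σ) (punchOut j≢i)))
              ≡⟨ unswap₀-correct {σ = lookup σ} σ-inv j σ0 (punchOut j≢i) ⟩
            lookup σ (suc (punchIn j (punchOut j≢i)))
              ≡⟨ cong (lookup σ ∘ suc) (punchIn-punchOut j≢i) ⟩
            lookup σ (suc i) ∎
        where open ≡-Reasoning

  Counts-involution-step : ∀ {c} → Counts IsSmaller c → Counts (IsInvolution (suc (suc m))) c
  Counts-involution-step = Counts-map {P = IsInvolution (suc (suc m))} {Q = IsSmaller} insert₀ delete₀ delete₀∘insert₀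
    (λ {x} → IsInvolution-insert₀ {x}) (λ {σ} → IsInvolution-delete₀ {σ}) (λ {σ} → insert₀∘delete₀ {σ})

Counts-involution : ∀ m → Counts (IsInvolution m) (telephone m)
Counts-involution zero = ([] ∷ []) , ([] ∷ []) , (λ { [] → mk⇔ (λ _ ()) (λ _ → here refl) }) , refl
Counts-involution (suc zero) = ((zero ∷ []) ∷ []) , ([] ∷ []) , members , refl
  where
  members : ∀ (σ : Vec (Fin 1) 1) → (σ ∈ (zero ∷ []) ∷ []) ⇔ IsInvolution 1 σ
  members (zero ∷ []) = mk⇔ (λ { _ zero → refl }) (λ _ → here refl)
Counts-involution (suc (suc m)) =
  Counts-involution-step (Counts-⊎ (Counts-involution (suc m)) (Counts-Fin× (suc m) (Counts-involution m)))

-- Binomial coefficients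

C-absorption : ∀ n k → suc k * (suc n C suc k) ≡ suc n * (n C k)
C-absorption zero    zero    = refl
C-absorption zero    (suc k) = *-zeroʳ (suc (suc k))
C-absorption (suc n) zero    = trans (*-identityˡ _) (trans (nC1≡n (suc (suc n))) (sym (*-identityʳ (suc (suc n)))))
C-absorption (suc n) (suc k) = begin
    suc (suc k) * (suc (suc n) C suc (suc k))
  ≡⟨ cong (suc (suc k) *_) (sym (nCk+nC[k+1]≡[n+1]C[k+1] (suc n) (suc k))) ⟩
    suc (suc k) * (suc n C suc k + suc n C suc (suc k))
  ≡⟨ *-distribˡ-+ (suc (suc k)) (suc n C suc k) _ ⟩
    suc n C suc k + suc k * (suc n C suc k) + suc (suc k) * (suc n C suc (suc k))
  ≡⟨ cong₂ (λ x y → suc n C suc k + x + y) (C-absorption n k) (C-absorption n (suc k)) ⟩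
    suc n C suc k + suc n * (n C k) + suc n * (n C suc k)
  ≡⟨ +-assoc (suc n C suc k) _ _ ⟩
    suc n C suc k + (suc n * (n C k) + suc n * (n C suc k))
  ≡⟨ cong (suc n C suc k +_) (trans (sym (*-distribˡ-+ (suc n) (n C k) _)) (cong (suc n *_) (nCk+nC[k+1]≡[n+1]C[k+1] n k))) ⟩
    suc (suc n) * (suc n C suc k)
  ∎
  where open ≡-Reasoning

C-absorption-split : ∀ n k → n * (n C k) ≡ k * (n C k) + suc k * (n C suc k)
C-absorption-split n k = +-cancelˡ-≡ (n C k) _ _ (begin
    n C k + n * (n C k)                         ≡⟨ sym (C-absorption n k) ⟩
    suc k * (suc n C suc k)                     ≡⟨ cong (suc k *_) (sym (nCk+nC[k+1]≡[n+1]C[k+1] n k)) ⟩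
    suc k * (n C k + n C suc k)                 ≡⟨ *-distribˡ-+ (suc k) (n C k) _ ⟩
    n C k + k * (n C k) + suc k * (n C suc k)   ≡⟨ +-assoc (n C k) _ _ ⟩
    n C k + (k * (n C k) + suc k * (n C suc k)) ∎)
  where open ≡-Reasoning

∸-*-C : ∀ n k → (n ∸ k) * (n C k) ≡ suc k * (n C suc k)
∸-*-C n k with k ≤? n
... | no k≰n rewrite k>n⇒nCk≡0 (m<n⇒m<1+n (≰⇒> k≰n)) | m≤n⇒m∸n≡0 (<⇒≤ (≰⇒> k≰n)) = sym (*-zeroʳ (suc k))
... | yes k≤n = +-cancelˡ-≡ (k * (n C k)) _ _ (begin
    k * (n C k) + (n ∸ k) * (n C k)    ≡⟨ sym (*-distribʳ-+ (n C k) k (n ∸ k)) ⟩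
    (k + (n ∸ k)) * (n C k)            ≡⟨ cong (_* (n C k)) (m+[n∸m]≡n k≤n) ⟩
    n * (n C k)                        ≡⟨ C-absorption-split n k ⟩
    k * (n C k) + suc k * (n C suc k)  ∎)
  where open ≡-Reasoning

telephone-suc : ∀ m → telephone (suc m) ≡ telephone m + m * telephone (pred m)
telephone-suc zero    = refl
telephone-suc (suc m) = refl

coeff : ℕ → ℕ → ℕ
coeff m i = (m C i) * telephone (m ∸ i)

coeff-above : ∀ m i → m < i → coeff m i ≡ 0
coeff-above m i m<i rewrite k>n⇒nCk≡0 m<i = refl

C*telephone-suc : ∀ m i → (m C i) * telephone (suc m ∸ i) ≡ coeff m i + suc i * coeff m (suc i)
C*telephone-suc m i with i ≤? m
... | no i≰m rewrite k>n⇒nCk≡0 (≰⇒> i≰m) | k>n⇒nCk≡0 (m<n⇒m<1+n (≰⇒> i≰m)) = sym (*-zeroʳ (suc i))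
... | yes i≤m = begin
    (m C i) * telephone (suc m ∸ i)
  ≡⟨ cong (λ d → (m C i) * telephone d) (+-∸-assoc 1 i≤m) ⟩
    (m C i) * telephone (suc (m ∸ i))
  ≡⟨ cong ((m C i) *_) (telephone-suc (m ∸ i)) ⟩
    (m C i) * (telephone (m ∸ i) + (m ∸ i) * telephone (pred (m ∸ i)))
  ≡⟨ cong (λ d → (m C i) * (telephone (m ∸ i) + (m ∸ i) * telephone d)) (pred[m∸n]≡m∸[1+n] m i) ⟩
    (m C i) * (telephone (m ∸ i) + (m ∸ i) * telephone (m ∸ suc i))
  ≡⟨ solve 4 (λ c t d t′ → c :* (t :+ d :* t′) := c :* t :+ (d :* c) :* t′) refl (m C i) (telephone (m ∸ i)) (m ∸ i) _ ⟩
    coeff m i + ((m ∸ i) * (m C i)) * telephone (m ∸ suc i)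
  ≡⟨ cong (λ x → coeff m i + x * telephone (m ∸ suc i)) (∸-*-C m i) ⟩
    coeff m i + (suc i * (m C suc i)) * telephone (m ∸ suc i)
  ≡⟨ cong (coeff m i +_) (*-assoc (suc i) (m C suc i) _) ⟩
    coeff m i + suc i * coeff m (suc i)
  ∎
  where
  open ≡-Reasoning
  open +-*-Solver

nextCoeff : (ℕ → ℕ) → ℕ → ℕ
nextCoeff c zero    = c 0 + c 1
nextCoeff c (suc j) = c j + c (suc j) + suc (suc j) * c (suc (suc j))

coeff-suc : ∀ m j → coeff (suc m) j ≡ nextCoeff (coeff m) j
coeff-suc m zero    = trans (C*telephone-suc m 0) (cong (coeff m 0 +_) (*-identityˡ (coeff m 1)))
coeff-suc m (suc j) = begin
    (suc m C suc j) * telephone (m ∸ j)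
  ≡⟨ cong (_* telephone (m ∸ j)) (sym (nCk+nC[k+1]≡[n+1]C[k+1] m j)) ⟩
    (m C j + m C suc j) * telephone (m ∸ j)
  ≡⟨ *-distribʳ-+ (telephone (m ∸ j)) (m C j) (m C suc j) ⟩
    coeff m j + (m C suc j) * telephone (suc m ∸ suc j)
  ≡⟨ cong (coeff m j +_) (C*telephone-suc m (suc j)) ⟩
    coeff m j + (coeff m (suc j) + suc (suc j) * coeff m (suc (suc j)))
  ≡⟨ sym (+-assoc (coeff m j) _ _) ⟩
    coeff m j + coeff m (suc j) + suc (suc j) * coeff m (suc (suc j))
  ∎
  where open ≡-Reasoning

-- Young's lattice

<ᵇ-true : ∀ {a b} → a < b → (a <ᵇ b) ≡ true
<ᵇ-true {zero}  {suc b} _         = refl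
<ᵇ-true {suc a} {suc b} (s≤s a<b) = <ᵇ-true a<b

<ᵇ-irrefl : ∀ a → (a <ᵇ a) ≡ false
<ᵇ-irrefl zero    = refl
<ᵇ-irrefl (suc a) = <ᵇ-irrefl a

Shape : Set
Shape = List ℕ

width : Shape → ℕ
width []      = 0
width (a ∷ _) = a

IsShape : Shape → Set
IsShape []      = ⊤
IsShape (a ∷ μ) = 1 ≤ a × width μ ≤ a × IsShape μ

-- The added cell may lengthen the first row only up to h, the length of the row above.
upWithin : ℕ → Shape → List Shape
upWithin h []      = singletonIf (0 <ᵇ h) (1 ∷ [])
upWithin h (a ∷ μ) = singletonIf (a <ᵇ h) (suc a ∷ μ) ++ map (a ∷_) (upWithin a μ)

up : Shape → List Shape
up μ = upWithin (suc (width μ)) μ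

consRow : ℕ → Shape → Shape
consRow zero    μ = μ
consRow (suc a) μ = suc a ∷ μ

shrinkFirst : ℕ → Shape → List Shape
shrinkFirst a μ = singletonIf (width μ <ᵇ a) (consRow (pred a) μ)

down : Shape → List Shape
down []      = []
down (a ∷ μ) = shrinkFirst a μ ++ map (a ∷_) (down μ)

∑-upWithin-∷ : ∀ (φ : Shape → ℕ) h a μ →
  ∑ (upWithin h (a ∷ μ)) φ ≡ ∑ (singletonIf (a <ᵇ h) (suc a ∷ μ)) φ + ∑[ ν ∈ upWithin a μ ] φ (a ∷ ν)
∑-upWithin-∷ φ h a μ = trans (∑-++ (singletonIf (a <ᵇ h) (suc a ∷ μ)) _ φ)
  (cong (∑ (singletonIf (a <ᵇ h) (suc a ∷ μ)) φ +_) (∑-map (a ∷_) (upWithin a μ) φ))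

∑-down-∷ : ∀ (φ : Shape → ℕ) a μ → ∑ (down (a ∷ μ)) φ ≡ ∑ (shrinkFirst a μ) φ + ∑[ ρ ∈ down μ ] φ (a ∷ ρ)
∑-down-∷ φ a μ = trans (∑-++ (shrinkFirst a μ) _ φ) (cong (∑ (shrinkFirst a μ) φ +_) (∑-map (a ∷_) (down μ) φ))

up-then-shrinkFirst : ∀ (φ : Shape → ℕ) k μ → width μ ≤ suc k →
  ∑[ ν ∈ upWithin (suc (suc k)) μ ] ∑ (shrinkFirst (suc (suc k)) ν) φ ≡ ∑[ ν ∈ upWithin (suc k) μ ] φ (suc k ∷ ν)
up-then-shrinkFirst φ k []      _   = cong (_+ 0) (+-identityʳ _)
up-then-shrinkFirst φ k (c ∷ μ) c≤ = begin
    ∑[ ν ∈ upWithin (suc (suc k)) (c ∷ μ) ] F ν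
  ≡⟨ ∑-upWithin-∷ F (suc (suc k)) c μ ⟩
    ∑ (singletonIf (c <ᵇ suc (suc k)) (suc c ∷ μ)) F + ∑[ ν ∈ upWithin c μ ] F (c ∷ ν)
  ≡⟨ cong₂ _+_ (cong (λ b → ∑ (singletonIf b (suc c ∷ μ)) F) (<ᵇ-true (s≤s c≤)))
               (∑-cong (upWithin c μ) (λ ν → cong (λ b → ∑ (singletonIf b (suc k ∷ c ∷ ν)) φ) (<ᵇ-true (s≤s c≤)))) ⟩
    ∑ (singletonIf (c <ᵇ suc k) (suc k ∷ suc c ∷ μ)) φ + 0 + ∑[ ν ∈ upWithin c μ ] (φ (suc k ∷ c ∷ ν) + 0)
  ≡⟨ cong₂ _+_ (trans (+-identityʳ _) (∑-singletonIf-map (c <ᵇ suc k) (suc k ∷_) (suc c ∷ μ) φ))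
               (∑-cong (upWithin c μ) (λ ν → +-identityʳ _)) ⟩
    ∑ (singletonIf (c <ᵇ suc k) (suc c ∷ μ)) (φ ∘ (suc k ∷_)) + ∑[ ν ∈ upWithin c μ ] φ (suc k ∷ c ∷ ν)
  ≡⟨ sym (∑-upWithin-∷ (φ ∘ (suc k ∷_)) (suc k) c μ) ⟩
    ∑[ ν ∈ upWithin (suc k) (c ∷ μ) ] φ (suc k ∷ ν)
  ∎
  where
  open ≡-Reasoning
  F : Shape → ℕ
  F ν = ∑ (shrinkFirst (suc (suc k)) ν) φ

up-then-shrinkFirst-full : ∀ (φ : Shape → ℕ) a μ → ∑[ ν ∈ upWithin a (a ∷ μ) ] ∑ (shrinkFirst a ν) φ ≡ 0
up-then-shrinkFirst-full φ a μ rewrite <ᵇ-irrefl a =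
  trans (∑-map (a ∷_) (upWithin a μ) _)
    (trans (∑-cong (upWithin a μ) (λ ν → cong (λ b → ∑ (singletonIf b (consRow (pred a) (a ∷ ν))) φ) (<ᵇ-irrefl a)))
           (∑-zero (upWithin a μ)))

shrinkFirst-then-up-long : ∀ (φ : Shape → ℕ) h k μ → width μ ≤ suc k → suc (suc k) ≤ h →
  ∑[ ν ∈ upWithin (suc (suc k)) μ ] ∑ (shrinkFirst (suc (suc k)) ν) φ
    + ∑[ ν ∈ singletonIf (width μ <ᵇ suc (suc k)) μ ] φ (suc (suc k) ∷ ν)
  ≡ ∑[ ρ ∈ shrinkFirst (suc (suc k)) μ ] ∑ (upWithin h ρ) φ
shrinkFirst-then-up-long φ h k μ w≤ 1+k<h = begin
    ∑[ ν ∈ upWithin (suc (suc k)) μ ] ∑ (shrinkFirst (suc (suc k)) ν) φ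
      + ∑[ ν ∈ singletonIf (width μ <ᵇ suc (suc k)) μ ] φ (suc (suc k) ∷ ν)
  ≡⟨ cong₂ _+_ (up-then-shrinkFirst φ k μ w≤) (cong (λ b → ∑[ ν ∈ singletonIf b μ ] φ (suc (suc k) ∷ ν)) (<ᵇ-true (s≤s w≤))) ⟩
    Y + (X + 0)
  ≡⟨ +-comm Y (X + 0) ⟩
    (X + 0) + Y
  ≡⟨ cong (λ b → ∑ (singletonIf b (suc (suc k) ∷ μ)) φ + Y) (sym (<ᵇ-true 1+k<h)) ⟩
    ∑ (singletonIf (suc k <ᵇ h) (suc (suc k) ∷ μ)) φ + Y
  ≡⟨ sym (∑-upWithin-∷ φ h (suc k) μ) ⟩
    ∑ (upWithin h (suc k ∷ μ)) φ
  ≡⟨ sym (+-identityʳ _) ⟩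
    ∑[ ρ ∈ singletonIf true (suc k ∷ μ) ] ∑ (upWithin h ρ) φ
  ≡⟨ cong (λ b → ∑[ ρ ∈ singletonIf b (suc k ∷ μ) ] ∑ (upWithin h ρ) φ) (sym (<ᵇ-true (s≤s w≤))) ⟩
    ∑[ ρ ∈ shrinkFirst (suc (suc k)) μ ] ∑ (upWithin h ρ) φ
  ∎
  where
  open ≡-Reasoning
  X = φ (suc (suc k) ∷ μ)
  Y = ∑[ ν ∈ upWithin (suc k) μ ] φ (suc k ∷ ν)

-- Shortening the first row commutes with adding a cell further down; the second summand on
-- the left counts the cell that was removed being added back.
shrinkFirst-then-up : ∀ (φ : Shape → ℕ) h a μ → IsShape (a ∷ μ) → a ≤ h →
  ∑[ ν ∈ upWithin a μ ] ∑ (shrinkFirst a ν) φ + ∑[ ν ∈ singletonIf (width μ <ᵇ a) μ ] φ (a ∷ ν)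
  ≡ ∑[ ρ ∈ shrinkFirst a μ ] ∑ (upWithin h ρ) φ
shrinkFirst-then-up φ (suc h) 1 [] _ _ = cong (_+ 0) (sym (+-identityʳ _))
shrinkFirst-then-up φ h 1 (1 ∷ μ) _ _ = cong (_+ 0) (up-then-shrinkFirst-full φ 1 μ)
shrinkFirst-then-up φ h 1 (suc (suc _) ∷ μ) (_ , s≤s () , _) _
shrinkFirst-then-up φ h (suc (suc k)) [] _ a≤h = shrinkFirst-then-up-long φ h k [] z≤n a≤h
shrinkFirst-then-up φ h (suc (suc k)) (c ∷ μ) (_ , c≤a , _) a≤h with m≤n⇒m<n∨m≡n c≤a
... | inj₁ (s≤s c≤k) = shrinkFirst-then-up-long φ h k (c ∷ μ) c≤k a≤h
... | inj₂ refl = trans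
  (cong₂ _+_ (up-then-shrinkFirst-full φ (suc (suc k)) μ)
             (cong (λ b → ∑[ ν ∈ singletonIf b (suc (suc k) ∷ μ) ] φ (suc (suc k) ∷ ν)) (<ᵇ-irrefl k)))
  (cong (λ b → ∑[ ρ ∈ singletonIf b (suc k ∷ suc (suc k) ∷ μ) ] ∑ (upWithin h ρ) φ) (sym (<ᵇ-irrefl k)))

grow-then-down : ∀ (φ : Shape → ℕ) a μ → width μ ≤ suc a → ∀ b →
  ∑[ ν ∈ singletonIf b (suc (suc a) ∷ μ) ] ∑ (down ν) φ
  ≡ ∑ (singletonIf b (suc a ∷ μ)) φ + ∑[ ρ ∈ down μ ] ∑ (singletonIf b (suc (suc a) ∷ ρ)) φ
grow-then-down φ a μ w≤ false = sym (∑-zero (down μ))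
grow-then-down φ a μ w≤ true  = begin
    ∑ (down (suc (suc a) ∷ μ)) φ + 0
  ≡⟨ +-identityʳ _ ⟩
    ∑ (down (suc (suc a) ∷ μ)) φ
  ≡⟨ ∑-down-∷ φ (suc (suc a)) μ ⟩
    ∑ (singletonIf (width μ <ᵇ suc (suc a)) (suc a ∷ μ)) φ + ∑[ ρ ∈ down μ ] φ (suc (suc a) ∷ ρ)
  ≡⟨ cong₂ _+_ (cong (λ b → ∑ (singletonIf b (suc a ∷ μ)) φ) (<ᵇ-true (s≤s w≤)))
               (∑-cong (down μ) (λ ρ → sym (+-identityʳ _))) ⟩
    ∑ (singletonIf true (suc a ∷ μ)) φ + ∑[ ρ ∈ down μ ] (φ (suc (suc a) ∷ ρ) + 0)
  ∎
  where open ≡-Reasoning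

DU≡UD+I-within : ∀ (φ : Shape → ℕ) h μ → IsShape μ → width μ ≤ h →
  ∑[ ν ∈ upWithin h μ ] ∑ (down ν) φ ≡ ∑ (singletonIf (width μ <ᵇ h) μ) φ + ∑[ ρ ∈ down μ ] ∑ (upWithin h ρ) φ
DU≡UD+I-within φ h [] _ _ with 0 <ᵇ h
... | true  = refl
... | false = refl
DU≡UD+I-within φ h (suc a ∷ μ) shape@(_ , w≤a , shape-μ) a≤h = begin
    ∑[ ν ∈ upWithin h (suc a ∷ μ) ] ∑ (down ν) φ
  ≡⟨ ∑-upWithin-∷ (λ ν → ∑ (down ν) φ) h (suc a) μ ⟩
    grown + ∑[ ν ∈ upWithin (suc a) μ ] ∑ (down (suc a ∷ ν)) φ
  ≡⟨ cong (grown +_) (∑-cong (upWithin (suc a) μ) (λ ν → ∑-down-∷ φ (suc a) ν)) ⟩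
    grown + ∑[ ν ∈ upWithin (suc a) μ ] (∑ (shrinkFirst (suc a) ν) φ + ∑ (down ν) φ′)
  ≡⟨ cong (grown +_) (∑-distrib-+ (upWithin (suc a) μ) (λ ν → ∑ (shrinkFirst (suc a) ν) φ) (λ ν → ∑ (down ν) φ′)) ⟩
    grown + (upShrink + ∑[ ν ∈ upWithin (suc a) μ ] ∑ (down ν) φ′)
  ≡⟨ cong (λ x → grown + (upShrink + x)) (DU≡UD+I-within φ′ (suc a) μ shape-μ w≤a) ⟩
    grown + (upShrink + (stay + downUp))
  ≡⟨ cong₂ _+_ (grow-then-down φ a μ w≤a (suc a <ᵇ h)) (sym (+-assoc upShrink stay downUp)) ⟩
    (growBack + downGrow) + ((upShrink + stay) + downUp)
  ≡⟨ cong (λ x → (growBack + downGrow) + (x + downUp)) (shrinkFirst-then-up φ h (suc a) μ shape a≤h) ⟩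
    (growBack + downGrow) + (shrinkUp + downUp)
  ≡⟨ solve 4 (λ a b c d → (a :+ b) :+ (c :+ d) := a :+ (c :+ (b :+ d))) refl growBack downGrow shrinkUp downUp ⟩
    growBack + (shrinkUp + (downGrow + downUp))
  ≡⟨ cong (λ x → growBack + (shrinkUp + x)) (sym (∑-distrib-+ (down μ) _ _)) ⟩
    growBack + (shrinkUp + ∑[ ρ ∈ down μ ] (∑ (singletonIf (suc a <ᵇ h) (suc (suc a) ∷ ρ)) φ + ∑ (upWithin (suc a) ρ) φ′))
  ≡⟨ cong (λ x → growBack + (shrinkUp + x)) (∑-cong (down μ) (λ ρ → sym (∑-upWithin-∷ φ h (suc a) ρ))) ⟩
    growBack + (shrinkUp + ∑[ ρ ∈ down μ ] ∑ (upWithin h (suc a ∷ ρ)) φ)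
  ≡⟨ cong (growBack +_) (sym (∑-down-∷ (λ ρ → ∑ (upWithin h ρ) φ) (suc a) μ)) ⟩
    growBack + ∑[ ρ ∈ down (suc a ∷ μ) ] ∑ (upWithin h ρ) φ
  ∎
  where
  open ≡-Reasoning
  open +-*-Solver
  φ′ : Shape → ℕ
  φ′ ν = φ (suc a ∷ ν)
  grown    = ∑[ ν ∈ singletonIf (suc a <ᵇ h) (suc (suc a) ∷ μ) ] ∑ (down ν) φ
  upShrink = ∑[ ν ∈ upWithin (suc a) μ ] ∑ (shrinkFirst (suc a) ν) φ
  stay     = ∑ (singletonIf (width μ <ᵇ suc a) μ) φ′
  downUp   = ∑[ ρ ∈ down μ ] ∑ (upWithin (suc a) ρ) φ′
  growBack = ∑ (singletonIf (suc a <ᵇ h) (suc a ∷ μ)) φ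
  downGrow = ∑[ ρ ∈ down μ ] ∑ (singletonIf (suc a <ᵇ h) (suc (suc a) ∷ ρ)) φ
  shrinkUp = ∑[ ρ ∈ shrinkFirst (suc a) μ ] ∑ (upWithin h ρ) φ

IsShape-upWithin : ∀ h μ → IsShape μ → width μ ≤ h → All (λ ν → IsShape ν × width ν ≤ h) (upWithin h μ)
IsShape-upWithin h [] _ _ = All-singletonIf (0 <ᵇ h) (λ 0<h → (s≤s z≤n , z≤n , tt) , <ᵇ⇒< 0 h 0<h)
IsShape-upWithin h (a ∷ μ) (1≤a , w≤a , shape-μ) a≤h = Allₚ.++⁺
  (All-singletonIf (a <ᵇ h) (λ a<h → (s≤s z≤n , m≤n⇒m≤1+n w≤a , shape-μ) , <ᵇ⇒< a h a<h))
  (Allₚ.map⁺ (All.map (λ (shape-ν , w≤) → (1≤a , w≤ , shape-ν) , a≤h) (IsShape-upWithin a μ shape-μ w≤a)))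

IsShape-up : ∀ μ → IsShape μ → All IsShape (up μ)
IsShape-up μ shape = All.map proj₁ (IsShape-upWithin (suc (width μ)) μ shape (n≤1+n _))

IsShape-down : ∀ μ → IsShape μ → All (λ ρ → IsShape ρ × width ρ ≤ width μ) (down μ)
IsShape-down [] _ = []
IsShape-down (a ∷ μ) (1≤a , w≤a , shape-μ) = Allₚ.++⁺
  (All-singletonIf (width μ <ᵇ a) (shrunk a 1≤a ∘ <ᵇ⇒< (width μ) a))
  (Allₚ.map⁺ (All.map (λ (shape-ρ , w≤) → (1≤a , ≤-trans w≤ w≤a , shape-ρ) , ≤-refl) (IsShape-down μ shape-μ)))
  where
  shrunk : ∀ a → 1 ≤ a → width μ < a → IsShape (consRow (pred a) μ) × width (consRow (pred a) μ) ≤ a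
  shrunk 1             _ w<a       = shape-μ , <⇒≤ w<a
  shrunk (suc (suc k)) _ (s≤s w≤k) = (s≤s z≤n , w≤k , shape-μ) , n≤1+n _

upWithin-cong : ∀ ρ {h h′} → width ρ < h → width ρ < h′ → upWithin h ρ ≡ upWithin h′ ρ
upWithin-cong []      w<h w<h′ rewrite <ᵇ-true w<h | <ᵇ-true w<h′ = refl
upWithin-cong (a ∷ ρ) w<h w<h′ rewrite <ᵇ-true w<h | <ᵇ-true w<h′ = refl

DU≡UD+I : ∀ (φ : Shape → ℕ) μ → IsShape μ → ∑[ ν ∈ up μ ] ∑ (down ν) φ ≡ φ μ + ∑[ ρ ∈ down μ ] ∑ (up ρ) φ
DU≡UD+I φ μ shape = trans (DU≡UD+I-within φ (suc (width μ)) μ shape (n≤1+n _)) (cong₂ _+_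
  (trans (cong (λ b → ∑ (singletonIf b μ) φ) (<ᵇ-true (n<1+n (width μ)))) (+-identityʳ (φ μ)))
  (∑-cong-local (IsShape-down μ shape) (λ {ρ} (_ , w≤) → cong (λ ν → ∑ ν φ) (upWithin-cong ρ (s≤s w≤) (n<1+n _)))))

∑-upWithin-1 : ∀ h μ → ∑[ ν ∈ upWithin h μ ] 1 ≡ ∑[ ν ∈ singletonIf (width μ <ᵇ h) μ ] 1 + ∑[ ρ ∈ down μ ] 1
∑-upWithin-1 h [] with 0 <ᵇ h
... | true  = refl
... | false = refl
∑-upWithin-1 h (a ∷ μ) = begin
    ∑[ ν ∈ upWithin h (a ∷ μ) ] 1
  ≡⟨ ∑-upWithin-∷ (λ _ → 1) h a μ ⟩
    ∑[ ν ∈ singletonIf (a <ᵇ h) (suc a ∷ μ) ] 1 + ∑[ ν ∈ upWithin a μ ] 1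
  ≡⟨ cong₂ _+_ (∑-singletonIf-const (a <ᵇ h) _ (a ∷ μ) 1) (∑-upWithin-1 a μ) ⟩
    ∑[ ν ∈ singletonIf (a <ᵇ h) (a ∷ μ) ] 1 + (∑[ ν ∈ singletonIf (width μ <ᵇ a) μ ] 1 + ∑[ ρ ∈ down μ ] 1)
  ≡⟨ cong (λ x → ∑[ ν ∈ singletonIf (a <ᵇ h) (a ∷ μ) ] 1 + (x + ∑[ ρ ∈ down μ ] 1))
          (∑-singletonIf-const (width μ <ᵇ a) μ (consRow (pred a) μ) 1) ⟩
    ∑[ ν ∈ singletonIf (a <ᵇ h) (a ∷ μ) ] 1 + (∑[ ρ ∈ shrinkFirst a μ ] 1 + ∑[ ρ ∈ down μ ] 1)
  ≡⟨ cong (∑[ ν ∈ singletonIf (a <ᵇ h) (a ∷ μ) ] 1 +_) (sym (∑-down-∷ (λ _ → 1) a μ)) ⟩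
    ∑[ ν ∈ singletonIf (a <ᵇ h) (a ∷ μ) ] 1 + ∑[ ρ ∈ down (a ∷ μ) ] 1
  ∎
  where open ≡-Reasoning

∑-up-1 : ∀ μ → ∑[ ν ∈ up μ ] 1 ≡ suc (∑[ ρ ∈ down μ ] 1)
∑-up-1 μ = trans (∑-upWithin-1 (suc (width μ)) μ)
  (cong (λ b → ∑[ ν ∈ singletonIf b μ ] 1 + ∑[ ρ ∈ down μ ] 1) (<ᵇ-true (n<1+n (width μ))))

downPaths : Shape → ℕ → ℕ
downPaths μ zero    = 1
downPaths μ (suc i) = ∑[ ρ ∈ down μ ] downPaths ρ i

upPaths : Shape → ℕ → ℕ
upPaths μ zero    = 1
upPaths μ (suc m) = ∑[ ν ∈ up μ ] upPaths ν m

∑-up-downPaths : ∀ i μ → IsShape μ →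
  ∑[ ν ∈ up μ ] downPaths ν i ≡ downPaths μ (suc i) + downPaths μ i + i * downPaths μ (pred i)
∑-up-downPaths zero μ _ = trans (∑-up-1 μ) (trans (+-comm 1 _) (sym (+-identityʳ _)))
∑-up-downPaths (suc i) μ shape = begin
    ∑[ ν ∈ up μ ] ∑[ ρ ∈ down ν ] downPaths ρ i
  ≡⟨ DU≡UD+I (λ ρ → downPaths ρ i) μ shape ⟩
    downPaths μ i + ∑[ ρ ∈ down μ ] ∑[ ν ∈ up ρ ] downPaths ν i
  ≡⟨ cong (downPaths μ i +_) (∑-cong-local (IsShape-down μ shape) (λ {ρ} (shape-ρ , _) → ∑-up-downPaths i ρ shape-ρ)) ⟩
    downPaths μ i + ∑[ ρ ∈ down μ ] (downPaths ρ (suc i) + downPaths ρ i + i * downPaths ρ (pred i))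
  ≡⟨ cong (downPaths μ i +_) (trans (∑-distrib-+ (down μ) _ _) (cong₂ _+_
       (∑-distrib-+ (down μ) (λ ρ → downPaths ρ (suc i)) (λ ρ → downPaths ρ i))
       (trans (∑-*ˡ (down μ) i (λ ρ → downPaths ρ (pred i))) (pred-step i)))) ⟩
    downPaths μ i + (downPaths μ (suc (suc i)) + downPaths μ (suc i) + i * downPaths μ i)
  ≡⟨ solve 4 (λ a b c i → a :+ (b :+ c :+ i :* a) := b :+ c :+ (con 1 :+ i) :* a) refl
       (downPaths μ i) (downPaths μ (suc (suc i))) (downPaths μ (suc i)) i ⟩
    downPaths μ (suc (suc i)) + downPaths μ (suc i) + suc i * downPaths μ i
  ∎
  where
  open ≡-Reasoning
  open +-*-Solver
  pred-step : ∀ i → i * ∑[ ρ ∈ down μ ] downPaths ρ (pred i) ≡ i * downPaths μ i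
  pred-step zero    = refl
  pred-step (suc i) = refl

-- Summation by parts: transfers the recurrence of ∑-up-downPaths from r to the coefficients.
∑<-nextCoeff : ∀ N (r c : ℕ → ℕ) → c N ≡ 0 → c (suc N) ≡ 0 →
  ∑[ i < N ] ((r (suc i) + r i + i * r (pred i)) * c i) ≡ ∑[ j < suc N ] (r j * nextCoeff c j)
∑<-nextCoeff N r c cN≡0 c1+N≡0 = begin
    ∑[ i < N ] ((r (suc i) + r i + i * r (pred i)) * c i)
  ≡⟨ ∑<-cong N (λ i _ → solve 4 (λ a b d e → (a :+ b :+ d) :* e := a :* e :+ b :* e :+ d :* e) refl (r (suc i)) (r i) (i * r (pred i)) (c i)) ⟩
    ∑[ i < N ] (r (suc i) * c i + r i * c i + i * r (pred i) * c i)
  ≡⟨ trans (∑<-distrib-+ N _ _) (cong (_+ ∑[ i < N ] (i * r (pred i) * c i)) (∑<-distrib-+ N _ _)) ⟩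
    lower + ∑[ i < N ] (r i * c i) + ∑[ i < N ] (i * r (pred i) * c i)
  ≡⟨ cong₂ (λ x y → lower + x + y) (∑<-shift N (λ i → r i * c i) (vanish (r N)))
       (trans (∑<-shift N (λ i → i * r (pred i) * c i) (vanish (N * r (pred N))))
              (∑<-shift N (λ i → suc i * r i * c (suc i)) (trans (cong (suc N * r N *_) c1+N≡0) (*-zeroʳ (suc N * r N))))) ⟩
    lower + (r 0 * c 0 + same) + (1 * r 0 * c 1 + upper)
  ≡⟨ solve 6 (λ l s u r0 c0 c1 → l :+ (r0 :* c0 :+ s) :+ (con 1 :* r0 :* c1 :+ u) := r0 :* (c0 :+ c1) :+ ((l :+ s) :+ u))
       refl lower same upper (r 0) (c 0) (c 1) ⟩
    r 0 * (c 0 + c 1) + ((lower + same) + upper)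
  ≡⟨ cong (r 0 * (c 0 + c 1) +_) (sym (trans (∑<-distrib-+ N _ _) (cong₂ _+_ (∑<-distrib-+ N _ _)
       (∑<-cong N (λ j _ → solve 3 (λ a k b → a :* (k :* b) := k :* a :* b) refl (r (suc j)) (suc (suc j)) (c (suc (suc j)))))))) ⟩
    r 0 * (c 0 + c 1) + ∑[ j < N ] (r (suc j) * c j + r (suc j) * c (suc j) + r (suc j) * (suc (suc j) * c (suc (suc j))))
  ≡⟨ cong (r 0 * (c 0 + c 1) +_) (∑<-cong N (λ j _ → solve 4 (λ a x y z → a :* x :+ a :* y :+ a :* z := a :* (x :+ y :+ z)) refl
       (r (suc j)) (c j) (c (suc j)) (suc (suc j) * c (suc (suc j))))) ⟩
    ∑[ j < suc N ] (r j * nextCoeff c j)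
  ∎
  where
  open ≡-Reasoning
  open +-*-Solver
  vanish : ∀ x → x * c N ≡ 0
  vanish x = trans (cong (x *_) cN≡0) (*-zeroʳ x)
  lower = ∑[ i < N ] (r (suc i) * c i)
  same  = ∑[ i < N ] (r (suc i) * c (suc i))
  upper = ∑[ i < N ] (suc (suc i) * r (suc i) * c (suc (suc i)))

upPaths-expansion : ∀ m μ → IsShape μ → upPaths μ m ≡ ∑[ i < suc m ] (downPaths μ i * coeff m i)
upPaths-expansion zero    μ _     = refl
upPaths-expansion (suc m) μ shape = begin
    ∑[ ν ∈ up μ ] upPaths ν m
  ≡⟨ ∑-cong-local (IsShape-up μ shape) (λ {ν} shape-ν → upPaths-expansion m ν shape-ν) ⟩
    ∑[ ν ∈ up μ ] ∑[ i < suc m ] (downPaths ν i * coeff m i)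
  ≡⟨ ∑-∑<-comm (up μ) (suc m) (λ ν i → downPaths ν i * coeff m i) ⟩
    ∑[ i < suc m ] ∑[ ν ∈ up μ ] (downPaths ν i * coeff m i)
  ≡⟨ ∑<-cong (suc m) (λ i _ → trans (∑-*ʳ (up μ) (coeff m i) (λ ν → downPaths ν i)) (cong (_* coeff m i) (∑-up-downPaths i μ shape))) ⟩
    ∑[ i < suc m ] ((downPaths μ (suc i) + downPaths μ i + i * downPaths μ (pred i)) * coeff m i)
  ≡⟨ ∑<-nextCoeff (suc m) (downPaths μ) (coeff m) (coeff-above m (suc m) (n<1+n m)) (coeff-above m (suc (suc m)) (m<n⇒m<1+n (n<1+n m))) ⟩
    ∑[ j < suc (suc m) ] (downPaths μ j * nextCoeff (coeff m) j)
  ≡⟨ ∑<-cong (suc (suc m)) (λ j _ → cong (downPaths μ j *_) (sym (coeff-suc m j))) ⟩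
    ∑[ j < suc (suc m) ] (downPaths μ j * coeff (suc m) j)
  ∎
  where open ≡-Reasoning

-- Standard Young tableaux

Tableau : Set
Tableau = List (List ℕ)

shape : Tableau → Shape
shape = map length

placeWithin : ℕ → Tableau → ℕ → List Tableau
placeWithin h []      x = singletonIf (0 <ᵇ h) ((x ∷ []) ∷ [])
placeWithin h (r ∷ T) x = singletonIf (length r <ᵇ h) ((r ++ x ∷ []) ∷ T) ++ map (r ∷_) (placeWithin (length r) T x)

place : Tableau → ℕ → List Tableau
place T x = placeWithin (suc (width (shape T))) T x

tableaux : ℕ → List Tableau
tableaux zero    = [] ∷ []
tableaux (suc n) = concatMap (λ T → place T (suc n)) (tableaux n)

extensions : Tableau → ℕ → ℕ → List Tableau
extensions T c zero    = T ∷ []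
extensions T c (suc m) = concatMap (λ T′ → extensions T′ (suc c) m) (place T (suc c))

length-∷ʳ : ∀ (r : List ℕ) x → length (r ++ x ∷ []) ≡ suc (length r)
length-∷ʳ r x = trans (length-++-sucʳ r x []) (cong (suc ∘ length) (++-identityʳ r))

shape-placeWithin : ∀ h T x → map shape (placeWithin h T x) ≡ upWithin h (shape T)
shape-placeWithin h [] x with 0 <ᵇ h
... | true  = refl
... | false = refl
shape-placeWithin h (r ∷ T) x = begin
    map shape (grown ++ map (r ∷_) Ts)
  ≡⟨ map-++ shape grown (map (r ∷_) Ts) ⟩
    map shape grown ++ map shape (map (r ∷_) Ts)
  ≡⟨ cong₂ _++_ (trans (map-singletonIf shape (length r <ᵇ h) _) (cong (λ a → singletonIf (length r <ᵇ h) (a ∷ shape T)) (length-∷ʳ r x)))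
                (trans (sym (map-∘ Ts)) (trans (map-∘ Ts) (cong (map (length r ∷_)) (shape-placeWithin (length r) T x)))) ⟩
    singletonIf (length r <ᵇ h) (suc (length r) ∷ shape T) ++ map (length r ∷_) (upWithin (length r) (shape T))
  ∎
  where
  open ≡-Reasoning
  grown = singletonIf (length r <ᵇ h) ((r ++ x ∷ []) ∷ T)
  Ts    = placeWithin (length r) T x

∑-tableaux-+ : ∀ (φ : Tableau → ℕ) c m → ∑ (tableaux (c + m)) φ ≡ ∑[ T ∈ tableaux c ] ∑ (extensions T c m) φ
∑-tableaux-+ φ c zero    rewrite +-identityʳ c = ∑-cong (tableaux c) (λ T → sym (+-identityʳ (φ T)))
∑-tableaux-+ φ c (suc m) rewrite +-suc c m = begin
    ∑ (tableaux (suc c + m)) φ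
  ≡⟨ ∑-tableaux-+ φ (suc c) m ⟩
    ∑[ T ∈ concatMap (λ T → place T (suc c)) (tableaux c) ] ∑ (extensions T (suc c) m) φ
  ≡⟨ ∑-concatMap (λ T → place T (suc c)) (tableaux c) _ ⟩
    ∑[ T ∈ tableaux c ] ∑[ T′ ∈ place T (suc c) ] ∑ (extensions T′ (suc c) m) φ
  ≡⟨ ∑-cong (tableaux c) (λ T → sym (∑-concatMap (λ T′ → extensions T′ (suc c) m) (place T (suc c)) φ)) ⟩
    ∑[ T ∈ tableaux c ] ∑ (extensions T c (suc m)) φ
  ∎
  where open ≡-Reasoning

∑-extensions-1 : ∀ T c m → ∑[ _ ∈ extensions T c m ] 1 ≡ upPaths (shape T) m
∑-extensions-1 T c zero    = refl
∑-extensions-1 T c (suc m) = begin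
    ∑[ _ ∈ extensions T c (suc m) ] 1
  ≡⟨ ∑-concatMap (λ T′ → extensions T′ (suc c) m) (place T (suc c)) _ ⟩
    ∑[ T′ ∈ place T (suc c) ] ∑[ _ ∈ extensions T′ (suc c) m ] 1
  ≡⟨ ∑-cong (place T (suc c)) (λ T′ → ∑-extensions-1 T′ (suc c) m) ⟩
    ∑[ T′ ∈ place T (suc c) ] upPaths (shape T′) m
  ≡⟨ sym (∑-map shape (place T (suc c)) (λ ν → upPaths ν m)) ⟩
    ∑[ ν ∈ map shape (place T (suc c)) ] upPaths ν m
  ≡⟨ cong (λ νs → ∑[ ν ∈ νs ] upPaths ν m) (shape-placeWithin _ T (suc c)) ⟩
    upPaths (shape T) (suc m)
  ∎
  where open ≡-Reasoning

∈-placeWithin-[]⁻ : ∀ h x {T′} → T′ ∈ placeWithin h [] x → T′ ≡ (x ∷ []) ∷ [] × 0 < h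
∈-placeWithin-[]⁻ h x T′∈ with ∈-singletonIf (0 <ᵇ h) T′∈
... | T′≡ , 0<h = T′≡ , <ᵇ⇒< 0 h 0<h

∈-placeWithin-∷⁻ : ∀ h r T x {T′} → T′ ∈ placeWithin h (r ∷ T) x →
  (T′ ≡ (r ++ x ∷ []) ∷ T × length r < h) ⊎ Σ Tableau (λ T″ → T″ ∈ placeWithin (length r) T x × T′ ≡ r ∷ T″)
∈-placeWithin-∷⁻ h r T x T′∈ with ∈-++⁻ (singletonIf (length r <ᵇ h) ((r ++ x ∷ []) ∷ T)) T′∈
... | inj₁ T′∈₁ with ∈-singletonIf (length r <ᵇ h) T′∈₁
...   | T′≡ , r<h = inj₁ (T′≡ , <ᵇ⇒< (length r) h r<h)
∈-placeWithin-∷⁻ h r T x T′∈ | inj₂ T′∈₂ with ∈-map⁻ _ T′∈₂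
...   | T″ , T″∈ , T′≡ = inj₂ (T″ , T″∈ , T′≡)

ColsBelow-growLower : ∀ a r x → ColsBelow a r → length r < length a → All (_< x) a → ColsBelow a (r ++ x ∷ [])
ColsBelow-growLower (_ ∷ _)  []       x _        _         (a<x ∷ _)  = a<x , tt
ColsBelow-growLower (_ ∷ as) (_ ∷ rs) x (p , cb) (s≤s r<a) (_ ∷ as<x) = p , ColsBelow-growLower as rs x cb r<a as<x

ColsBelow-growUpper : ∀ a s r → ColsBelow a r → ColsBelow (a ++ s) r
ColsBelow-growUpper a        s []       _        = tt
ColsBelow-growUpper (_ ∷ as) s (_ ∷ rs) (p , cb) = p , ColsBelow-growUpper as s rs cb

ColsBelow-shrinkLower : ∀ a r s → ColsBelow a (r ++ s) → ColsBelow a r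
ColsBelow-shrinkLower a        []       s _        = tt
ColsBelow-shrinkLower (_ ∷ as) (_ ∷ rs) s (p , cb) = p , ColsBelow-shrinkLower as rs s cb

ColsBelow-shrinkUpper : ∀ a s r → ColsBelow (a ++ s) r → length r ≤ length a → ColsBelow a r
ColsBelow-shrinkUpper a        s []       _        _         = tt
ColsBelow-shrinkUpper (_ ∷ as) s (_ ∷ rs) (p , cb) (s≤s r≤a) = p , ColsBelow-shrinkUpper as s rs cb r≤a

Linked-∷ʳ : ∀ r x → Linked _<_ r → All (_< x) r → Linked _<_ (r ++ x ∷ [])
Linked-∷ʳ []           x _       _              = [-]
Linked-∷ʳ (_ ∷ [])     x _       (y<x ∷ _)      = y<x ∷ [-]
Linked-∷ʳ (_ ∷ z ∷ rs) x (p ∷ l) (_ ∷ z∷rs<x)   = p ∷ Linked-∷ʳ (z ∷ rs) x l z∷rs<x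

Linked-++⁻ˡ : ∀ {R : ℕ → ℕ → Set} r s → Linked R (r ++ s) → Linked R r
Linked-++⁻ˡ []           s _       = []
Linked-++⁻ˡ (_ ∷ [])     s _       = [-]
Linked-++⁻ˡ (_ ∷ z ∷ rs) s (p ∷ l) = p ∷ Linked-++⁻ˡ (z ∷ rs) s l

NonEmpty-∷ʳ : ∀ (r : List ℕ) x → NonEmpty (r ++ x ∷ [])
NonEmpty-∷ʳ []      x = tt
NonEmpty-∷ʳ (_ ∷ _) x = tt

firstRow : Tableau → List ℕ
firstRow []      = []
firstRow (r ∷ _) = r

RowsRel-∷ : ∀ a T → RowsRel a (firstRow T) → Linked RowsRel T → Linked RowsRel (a ∷ T)
RowsRel-∷ a []      _ _ = [-]
RowsRel-∷ a (r ∷ T) p l = p ∷ l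

RowsRel-head : ∀ a T → Linked RowsRel (a ∷ T) → RowsRel a (firstRow T)
RowsRel-head a []      _       = z≤n , tt
RowsRel-head a (r ∷ T) (p ∷ _) = p

RowsRel-growUpper : ∀ r x T → Linked RowsRel (r ∷ T) → Linked RowsRel ((r ++ x ∷ []) ∷ T)
RowsRel-growUpper r x []       _                  = [-]
RowsRel-growUpper r x (r′ ∷ T) ((r′≤r , cb) ∷ l) =
  (≤-trans r′≤r (subst (length r ≤_) (sym (length-∷ʳ r x)) (n≤1+n _)) , ColsBelow-growUpper r (x ∷ []) r′ cb) ∷ l

IsTableau : Tableau → Set
IsTableau T = All NonEmpty T × Linked RowsRel T × All (Linked _<_) T

IsTableau-∷-placeWithin : ∀ a T x → NonEmpty a → All (_< x) a → IsTableau (a ∷ T) → All (_< x) (concat T) →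
  ∀ {T′} → T′ ∈ placeWithin (length a) T x → IsTableau (a ∷ T′)
IsTableau-∷-placeWithin [] _ _ () _ _ _ _
IsTableau-∷-placeWithin a@(_ ∷ _) [] x _ (a₀<x ∷ _) (_ , _ , a↑ ∷ []) _ T′∈ with ∈-placeWithin-[]⁻ (length a) x T′∈
... | refl , _ = (tt ∷ tt ∷ []) , ((s≤s z≤n , a₀<x , tt) ∷ [-]) , (a↑ ∷ [-] ∷ [])
IsTableau-∷-placeWithin a (r ∷ T) x a≠[] a<x (_ ∷ r≠[] ∷ T≠[] , (a-r@(_ , cb) ∷ l) , a↑ ∷ r↑ ∷ T↑) r∷T<x T′∈
  with ∈-placeWithin-∷⁻ (length a) r T x T′∈
... | inj₁ (refl , r<a) =
  (a≠[] ∷ NonEmpty-∷ʳ r x ∷ T≠[]) ,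
  ((subst (_≤ length a) (sym (length-∷ʳ r x)) r<a , ColsBelow-growLower a r x cb r<a a<x) ∷ RowsRel-growUpper r x T l) ,
  (a↑ ∷ Linked-∷ʳ r x r↑ (Allₚ.++⁻ˡ r r∷T<x) ∷ T↑)
... | inj₂ (T″ , T″∈ , refl)
  with IsTableau-∷-placeWithin r T x r≠[] (Allₚ.++⁻ˡ r r∷T<x) (r≠[] ∷ T≠[] , l , r↑ ∷ T↑) (Allₚ.++⁻ʳ r r∷T<x) T″∈
...   | ne , l′ , inc = (a≠[] ∷ ne) , (a-r ∷ l′) , (a↑ ∷ inc)

IsTableau-place : ∀ T x → IsTableau T → All (_< x) (concat T) → ∀ {T′} → T′ ∈ place T x → IsTableau T′
IsTableau-place [] x _ _ (here refl) = (tt ∷ []) , [-] , ([-] ∷ [])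
IsTableau-place (r ∷ T) x tab@(r≠[] ∷ T≠[] , l , r↑ ∷ T↑) r∷T<x T′∈ with ∈-placeWithin-∷⁻ (suc (length r)) r T x T′∈
... | inj₁ (refl , _) = (NonEmpty-∷ʳ r x ∷ T≠[]) , RowsRel-growUpper r x T l , (Linked-∷ʳ r x r↑ (Allₚ.++⁻ˡ r r∷T<x) ∷ T↑)
... | inj₂ (T″ , T″∈ , refl) = IsTableau-∷-placeWithin r T x r≠[] (Allₚ.++⁻ˡ r r∷T<x) tab (Allₚ.++⁻ʳ r r∷T<x) T″∈

concat-placeWithin : ∀ h T x {T′} → T′ ∈ placeWithin h T x → concat T′ ↭ x ∷ concat T
concat-placeWithin h [] x T′∈ with ∈-placeWithin-[]⁻ h x T′∈
... | refl , _ = ↭-refl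
concat-placeWithin h (r ∷ T) x T′∈ with ∈-placeWithin-∷⁻ h r T x T′∈
... | inj₁ (refl , _) = subst (_↭ x ∷ r ++ concat T) (sym (++-assoc r (x ∷ []) (concat T))) (shift x r (concat T))
... | inj₂ (T″ , T″∈ , refl) = ↭-trans (++⁺ˡ r (concat-placeWithin (length r) T x T″∈)) (shift x r (concat T))

∈-suc-upTo : ∀ {n y} → y ∈ map suc (upTo n) → 1 ≤ y × y ≤ n
∈-suc-upTo y∈ with ∈-map⁻ suc y∈
... | i , i∈ , refl = s≤s z≤n , ∈-upTo⁻ i∈

suc-upTo-∷ʳ : ∀ n → map suc (upTo (suc n)) ↭ suc n ∷ map suc (upTo n)
suc-upTo-∷ʳ n = subst (_↭ suc n ∷ map suc (upTo n)) ∷ʳ≡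
  (subst (λ l → map suc (upTo n) ++ suc n ∷ [] ↭ suc n ∷ l) (++-identityʳ _) (shift (suc n) (map suc (upTo n)) []))
  where
  ∷ʳ≡ : map suc (upTo n) ++ suc n ∷ [] ≡ map suc (upTo (suc n))
  ∷ʳ≡ = trans (sym (map-++ suc (upTo n) (n ∷ []))) (cong (map suc) (upTo-∷ʳ n))

IsSYT-entries : ∀ n T → IsSYT n T → All (λ y → 1 ≤ y × y ≤ n) (concat T)
IsSYT-entries n T (_ , _ , _ , T↭) = All.tabulate (∈-suc-upTo ∘ ∈-resp-↭ T↭)

IsSYT-place : ∀ n T → IsSYT n T → ∀ {T′} → T′ ∈ place T (suc n) → IsSYT (suc n) T′
IsSYT-place n T syt@(T≠[] , l , inc , T↭) T′∈
  with IsTableau-place T (suc n) (T≠[] , l , inc) (All.map (s≤s ∘ proj₂) (IsSYT-entries n T syt)) T′∈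
... | ne′ , l′ , inc′ = ne′ , l′ , inc′ ,
  ↭-trans (concat-placeWithin _ T (suc n) T′∈) (↭-trans (prep (suc n) T↭) (↭-sym (suc-upTo-∷ʳ n)))

-- The largest entry of a tableau ends some row; erasing it inverts place.
eraseRow : ℕ → List ℕ → List ℕ
eraseRow x [] = []
eraseRow x (y ∷ ys) with y ≟ x
... | yes _ = eraseRow x ys
... | no _  = y ∷ eraseRow x ys

consNonEmpty : List ℕ → Tableau → Tableau
consNonEmpty []       T = T
consNonEmpty (y ∷ ys) T = (y ∷ ys) ∷ T

erase : ℕ → Tableau → Tableau
erase x []      = []
erase x (r ∷ T) = consNonEmpty (eraseRow x r) (erase x T)

eraseRow-∉ : ∀ x r → x ∉ r → eraseRow x r ≡ r
eraseRow-∉ x []       _   = refl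
eraseRow-∉ x (y ∷ ys) x∉ with y ≟ x
... | yes refl = ⊥-elim (x∉ (here refl))
... | no _     = cong (y ∷_) (eraseRow-∉ x ys (x∉ ∘ there))

eraseRow-∷ʳ : ∀ x r → x ∉ r → eraseRow x (r ++ x ∷ []) ≡ r
eraseRow-∷ʳ x [] _ with x ≟ x
... | yes _   = refl
... | no x≢x = ⊥-elim (x≢x refl)
eraseRow-∷ʳ x (y ∷ ys) x∉ with y ≟ x
... | yes refl = ⊥-elim (x∉ (here refl))
... | no _     = cong (y ∷_) (eraseRow-∷ʳ x ys (x∉ ∘ there))

eraseRow-last : ∀ x r → Linked _<_ r → All (_≤ x) r → x ∈ r → eraseRow x r ++ x ∷ [] ≡ r
eraseRow-last x (y ∷ []) _ _ (here refl) with y ≟ y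
... | yes _   = refl
... | no y≢y = ⊥-elim (y≢y refl)
eraseRow-last x (y ∷ z ∷ zs) (y<z ∷ l) (_ ∷ z∷zs≤x) x∈ with y ≟ x
... | yes refl = ⊥-elim (<-irrefl refl (<-≤-trans y<z (All.head z∷zs≤x)))
... | no y≢x   = cong (y ∷_) (eraseRow-last x (z ∷ zs) l z∷zs≤x (tail x∈))
  where
  tail : x ∈ y ∷ z ∷ zs → x ∈ z ∷ zs
  tail (here x≡y) = ⊥-elim (y≢x (sym x≡y))
  tail (there x∈) = x∈

concat-consNonEmpty : ∀ r T → concat (consNonEmpty r T) ≡ r ++ concat T
concat-consNonEmpty []      T = refl
concat-consNonEmpty (_ ∷ _) T = refl

erase-∉ : ∀ x T → x ∉ concat T → All NonEmpty T → erase x T ≡ T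
erase-∉ x []             _  _         = refl
erase-∉ x ((y ∷ ys) ∷ T) x∉ (_ ∷ T≠[])
  rewrite eraseRow-∉ x (y ∷ ys) (x∉ ∘ ∈-++⁺ˡ) | erase-∉ x T (x∉ ∘ ∈-++⁺ʳ (y ∷ ys)) T≠[] = refl

erase-placeWithin : ∀ x h T → x ∉ concat T → All NonEmpty T → ∀ {T′} → T′ ∈ placeWithin h T x → erase x T′ ≡ T
erase-placeWithin x h [] _ _ T′∈ with ∈-placeWithin-[]⁻ h x T′∈
... | refl , _ with x ≟ x
...   | yes _   = refl
...   | no x≢x = ⊥-elim (x≢x refl)
erase-placeWithin x h ((y ∷ ys) ∷ T) x∉ (_ ∷ T≠[]) T′∈ with ∈-placeWithin-∷⁻ h (y ∷ ys) T x T′∈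
... | inj₁ (refl , _)
  rewrite eraseRow-∷ʳ x (y ∷ ys) (x∉ ∘ ∈-++⁺ˡ) | erase-∉ x T (x∉ ∘ ∈-++⁺ʳ (y ∷ ys)) T≠[] = refl
... | inj₂ (T″ , T″∈ , refl)
  rewrite eraseRow-∉ x (y ∷ ys) (x∉ ∘ ∈-++⁺ˡ) | erase-placeWithin x (length (y ∷ ys)) T (x∉ ∘ ∈-++⁺ʳ (y ∷ ys)) T≠[] T″∈ = refl

Unique-++⁻ʳ : ∀ (r : List ℕ) {L} → Unique (r ++ L) → Unique L
Unique-++⁻ʳ []      L! = L!
Unique-++⁻ʳ (_ ∷ r) (_ ∷ rL!) = Unique-++⁻ʳ r rL!

Unique-++-disjoint : ∀ (r : List ℕ) {L x} → Unique (r ++ L) → x ∈ r → x ∉ L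
Unique-++-disjoint (_ ∷ r) (y∉ ∷ _)  (here refl) x∈L = All.lookup (Allₚ.++⁻ʳ r y∉) x∈L refl
Unique-++-disjoint (_ ∷ r) (_ ∷ rL!) (there x∈r) x∈L = Unique-++-disjoint r rL! x∈r x∈L

RowsRel-shrinkUpper : ∀ r x r′ → RowsRel (r ++ x ∷ []) r′ → All (_≤ x) r′ → RowsRel r r′
RowsRel-shrinkUpper r x r′ (r′≤ , cb) r′≤x = r′≤r , ColsBelow-shrinkUpper r (x ∷ []) r′ cb r′≤r
  where
  fits : ∀ r r′ → ColsBelow (r ++ x ∷ []) r′ → length r′ ≤ suc (length r) → All (_≤ x) r′ → length r′ ≤ length r
  fits []      []      _        _         _          = z≤n
  fits []      (_ ∷ _) (y<x , _) _        (x≤y ∷ _)  = ⊥-elim (<-irrefl refl (<-≤-trans y<x x≤y))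
  fits (_ ∷ _) []      _        _         _          = z≤n
  fits (_ ∷ r) (_ ∷ r′) (_ , cb) (s≤s r′≤) (_ ∷ r′≤x) = s≤s (fits r r′ cb r′≤ r′≤x)
  r′≤r = fits r r′ cb (subst (length r′ ≤_) (length-∷ʳ r x) r′≤) r′≤x

All-firstRow : ∀ {P : ℕ → Set} T → All P (concat T) → All P (firstRow T)
All-firstRow []      _   = []
All-firstRow (r ∷ T) all = Allₚ.++⁻ˡ r all

IsTableau≤ : ℕ → Tableau → Set
IsTableau≤ x T = IsTableau T × All (_≤ x) (concat T) × Unique (concat T)

IsTableau≤-tail : ∀ x r T → IsTableau≤ x (r ∷ T) → IsTableau≤ x T
IsTableau≤-tail x r T ((_ ∷ T≠[] , l , _ ∷ T↑) , ≤x , !) = (T≠[] , Linked.tail l , T↑) , Allₚ.++⁻ʳ r ≤x , Unique-++⁻ʳ r !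

singleton-row-is-last : ∀ x T → IsTableau≤ x ((x ∷ []) ∷ T) → T ≡ []
singleton-row-is-last x []             _ = refl
singleton-row-is-last x ([] ∷ T)       ((_ ∷ () ∷ _ , _) , _)
singleton-row-is-last x ((_ ∷ _) ∷ T)  ((_ , ((_ , x<y , _) ∷ _) , _) , ≤x , _) =
  ⊥-elim (<-irrefl refl (<-≤-trans x<y (All.head (Allₚ.++⁻ʳ (x ∷ []) ≤x))))

∈-concat-∷⁻ : ∀ {x : ℕ} r (T : Tableau) → x ∉ r → x ∈ concat (r ∷ T) → x ∈ concat T
∈-concat-∷⁻ r T x∉r x∈ with ∈-++⁻ r x∈
... | inj₁ x∈r = ⊥-elim (x∉r x∈r)
... | inj₂ x∈T = x∈T

∈-placeWithin-erase : ∀ x h T → IsTableau≤ x T → x ∈ concat T → 1 ≤ h → (x ∈ firstRow T → length (firstRow T) ≤ h) →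
  T ∈ placeWithin h (erase x T) x
∈-placeWithin-erase x h (r ∷ T) tab@((_ ∷ T≠[] , l , r↑ ∷ _) , ≤x , !) x∈ 1≤h fits with x ∈? r
... | yes x∈r with eraseRow x r | eraseRow-last x r r↑ (Allₚ.++⁻ˡ r ≤x) x∈r | erase-∉ x T (Unique-++-disjoint r ! x∈r) T≠[]
...   | []     | refl | erased rewrite erased | singleton-row-is-last x T tab | <ᵇ-true 1≤h = here refl
...   | y ∷ ys | refl | erased rewrite erased | <ᵇ-true (subst (_≤ h) (length-∷ʳ (y ∷ ys) x) (fits x∈r)) = here refl
∈-placeWithin-erase x h ((y ∷ ys) ∷ T) tab@((_ , l , _) , _) x∈ 1≤h fits | no x∉r rewrite eraseRow-∉ x (y ∷ ys) x∉r =
  ∈-++⁺ʳ _ (∈-map⁺ ((y ∷ ys) ∷_) (∈-placeWithin-erase x (length (y ∷ ys)) T (IsTableau≤-tail x (y ∷ ys) T tab)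
    (∈-concat-∷⁻ (y ∷ ys) T x∉r x∈) (s≤s z≤n) (λ _ → proj₁ (RowsRel-head (y ∷ ys) T l))))

IsTableau-erase : ∀ x T → IsTableau≤ x T →
  IsTableau (erase x T) × (∀ a → RowsRel a (firstRow T) → RowsRel a (firstRow (erase x T)))
IsTableau-erase x [] _ = ([] , [] , []) , (λ _ p → p)
IsTableau-erase x (r ∷ T) tab@((_ ∷ T≠[] , l , r↑ ∷ T↑) , ≤x , !) with x ∈? r
... | yes x∈r with eraseRow x r | eraseRow-last x r r↑ (Allₚ.++⁻ˡ r ≤x) x∈r | erase-∉ x T (Unique-++-disjoint r ! x∈r) T≠[]
...   | []     | refl | erased rewrite erased | singleton-row-is-last x T tab = ([] , [] , []) , (λ _ _ → z≤n , tt)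
...   | y ∷ ys | refl | erased rewrite erased =
  (tt ∷ T≠[] ,
   RowsRel-∷ (y ∷ ys) T (RowsRel-shrinkUpper (y ∷ ys) x (firstRow T) (RowsRel-head _ T l)
     (All-firstRow T (Allₚ.++⁻ʳ ((y ∷ ys) ++ x ∷ []) ≤x))) (Linked.tail l) ,
   Linked-++⁻ˡ (y ∷ ys) (x ∷ []) r↑ ∷ T↑) ,
  (λ a (r≤a , cb) → ≤-trans (subst (length (y ∷ ys) ≤_) (sym (length-∷ʳ (y ∷ ys) x)) (n≤1+n _)) r≤a ,
                    ColsBelow-shrinkLower a (y ∷ ys) (x ∷ []) cb)
IsTableau-erase x ((y ∷ ys) ∷ T) tab@((_ , l , r↑ ∷ _) , _) | no x∉r rewrite eraseRow-∉ x (y ∷ ys) x∉r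
  with IsTableau-erase x T (IsTableau≤-tail x (y ∷ ys) T tab)
... | (T≠[] , l′ , T↑) , head′ =
  (tt ∷ T≠[] , RowsRel-∷ (y ∷ ys) (erase x T) (head′ (y ∷ ys) (RowsRel-head (y ∷ ys) T l)) l′ , r↑ ∷ T↑) , (λ _ p → p)

concat-erase : ∀ x T → IsTableau≤ x T → x ∈ concat T → concat T ↭ x ∷ concat (erase x T)
concat-erase x (r ∷ T) tab@((_ ∷ T≠[] , _ , r↑ ∷ _) , ≤x , !) x∈ with x ∈? r
... | yes x∈r with eraseRow x r | eraseRow-last x r r↑ (Allₚ.++⁻ˡ r ≤x) x∈r | erase-∉ x T (Unique-++-disjoint r ! x∈r) T≠[]
...   | r₀ | refl | erased rewrite erased | concat-consNonEmpty r₀ T =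
  subst (_↭ x ∷ r₀ ++ concat T) (sym (++-assoc r₀ (x ∷ []) (concat T))) (shift x r₀ (concat T))
concat-erase x ((y ∷ ys) ∷ T) tab x∈ | no x∉r rewrite eraseRow-∉ x (y ∷ ys) x∉r =
  ↭-trans (++⁺ˡ (y ∷ ys) (concat-erase x T (IsTableau≤-tail x (y ∷ ys) T tab) (∈-concat-∷⁻ (y ∷ ys) T x∉r x∈)))
          (shift x (y ∷ ys) (concat (erase x T)))

width-consNonEmpty : ∀ r T → length r ≤ width (shape (consNonEmpty r T))
width-consNonEmpty []      T = z≤n
width-consNonEmpty (_ ∷ _) T = ≤-refl

IsSYT-erase : ∀ n T → IsSYT (suc n) T → Σ Tableau λ T₀ → IsSYT n T₀ × T ∈ place T₀ (suc n)
IsSYT-erase n T syt@(T≠[] , l , inc , T↭) =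
  let (ne′ , l′ , inc′) , _ = IsTableau-erase x T tab≤ in
  erase x T ,
  (ne′ , l′ , inc′ , drop-∷ (↭-trans (↭-sym (concat-erase x T tab≤ x∈)) (↭-trans T↭ (suc-upTo-∷ʳ n)))) ,
  ∈-placeWithin-erase x _ T tab≤ x∈ (s≤s z≤n) (fits T tab≤)
  where
  x = suc n
  tab≤ : IsTableau≤ x T
  tab≤ = (T≠[] , l , inc) , All.map proj₂ (IsSYT-entries (suc n) T syt) ,
         Permₛ.Unique-resp-↭ (setoid ℕ) (↭⇒↭ₛ (↭-sym T↭)) (Unique.map⁺ suc-injective (Unique.upTo⁺ (suc n)))
  x∈ : x ∈ concat T
  x∈ = ∈-resp-↭ (↭-sym T↭) (∈-map⁺ suc (∈-upTo⁺ (n<1+n n)))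
  fits : ∀ T → IsTableau≤ x T → x ∈ firstRow T → length (firstRow T) ≤ suc (width (shape (erase x T)))
  fits (r ∷ T) ((_ , _ , r↑ ∷ _) , ≤x , _) x∈r =
    subst (_≤ suc (width (shape (erase x (r ∷ T)))))
      (trans (sym (length-∷ʳ (eraseRow x r) x)) (cong length (eraseRow-last x r r↑ (Allₚ.++⁻ˡ r ≤x) x∈r)))
      (s≤s (width-consNonEmpty (eraseRow x r) (erase x T)))

tableaux-sound : ∀ n {T} → T ∈ tableaux n → IsSYT n T
tableaux-sound zero    (here refl) = [] , [] , [] , ↭-refl
tableaux-sound (suc n) T∈ with ∈-concat⁻′ (map (λ T → place T (suc n)) (tableaux n)) T∈
... | _ , T∈′ , placed∈ with ∈-map⁻ (λ T → place T (suc n)) placed∈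
...   | T₀ , T₀∈ , refl = IsSYT-place n T₀ (tableaux-sound n T₀∈) T∈′

tableaux-complete : ∀ n T → IsSYT n T → T ∈ tableaux n
tableaux-complete zero    []             _                  = here refl
tableaux-complete zero    ([] ∷ T)       (() ∷ _ , _)
tableaux-complete zero    ((_ ∷ _) ∷ T)  (_ , _ , _ , T↭) with ↭-empty-inv T↭
... | ()
tableaux-complete (suc n) T syt with IsSYT-erase n T syt
... | T₀ , syt₀ , T∈ = ∈-concat⁺′ T∈ (∈-map⁺ (λ T → place T (suc n)) (tableaux-complete n T₀ syt₀))

∷ʳ-≢ : ∀ (r : List ℕ) x → r ++ x ∷ [] ≢ r
∷ʳ-≢ r x r∷ʳx≡r = <-irrefl refl (subst (_≤ length r) (length-∷ʳ r x) (≤-reflexive (cong length r∷ʳx≡r)))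

Unique-placeWithin : ∀ h T x → Unique (placeWithin h T x)
Unique-placeWithin h []      x = Unique-singletonIf (0 <ᵇ h) _
Unique-placeWithin h (r ∷ T) x =
  Unique.++⁺ (Unique-singletonIf (length r <ᵇ h) _) (Unique.map⁺ ∷-injectiveʳ (Unique-placeWithin (length r) T x)) disjoint
  where
  disjoint : ∀ {T′} → ¬ (T′ ∈ singletonIf (length r <ᵇ h) ((r ++ x ∷ []) ∷ T) × T′ ∈ map (r ∷_) (placeWithin (length r) T x))
  disjoint (T′∈₁ , T′∈₂) with ∈-singletonIf (length r <ᵇ h) T′∈₁ | ∈-map⁻ (r ∷_) T′∈₂
  ... | refl , _ | _ , _ , T′≡ = ∷ʳ-≢ r x (cong firstRow T′≡)

AllPairs-combine : {A : Set} {R S : A → A → Set} {P : A → Set} {xs : List A} → AllPairs R xs → All P xs →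
  (∀ {a b} → P a → P b → R a b → S a b) → AllPairs S xs
AllPairs-combine []         []         f = []
AllPairs-combine (Rx ∷ Rxs) (px ∷ pxs) f = All.zipWith (λ (py , Rxy) → f px py Rxy) (pxs , Rx) ∷ AllPairs-combine Rxs pxs f

tableaux-unique : ∀ n → Unique (tableaux n)
tableaux-unique zero    = [] ∷ []
tableaux-unique (suc n) =
  Unique.concat⁺ (Allₚ.map⁺ (All.universal (λ T → Unique-placeWithin _ T (suc n)) (tableaux n)))
                 (AllPairsₚ.map⁺ (AllPairs-combine (tableaux-unique n) (All.tabulate (tableaux-sound n)) disjoint))
  where
  n+1∉ : ∀ {T} → IsSYT n T → suc n ∉ concat T
  n+1∉ {T} syt n+1∈ = <-irrefl refl (s≤s (proj₂ (All.lookup (IsSYT-entries n T syt) n+1∈)))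
  disjoint : ∀ {T₁ T₂} → IsSYT n T₁ → IsSYT n T₂ → T₁ ≢ T₂ → ∀ {T} → ¬ (T ∈ place T₁ (suc n) × T ∈ place T₂ (suc n))
  disjoint syt₁@(ne₁ , _) syt₂@(ne₂ , _) T₁≢T₂ (T∈₁ , T∈₂) =
    T₁≢T₂ (trans (sym (erase-placeWithin (suc n) _ _ (n+1∉ syt₁) ne₁ T∈₁)) (erase-placeWithin (suc n) _ _ (n+1∉ syt₂) ne₂ T∈₂))

entry12? : ∀ T k → Dec (Entry12 T k)
entry12? []                       k = no λ { (_ , _ , _ , ()) }
entry12? ([] ∷ _)                 k = no λ { (_ , _ , _ , ()) }
entry12? ((_ ∷ []) ∷ _)           k = no λ { (_ , _ , _ , ()) }
entry12? ((x ∷ y ∷ rest) ∷ rows) k = map′ (λ { refl → x , rest , rows , refl }) (λ { (_ , _ , _ , refl) → refl }) (y ≟ k)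

δ : ℕ → ℕ → ℕ
δ a b = if a ≡ᵇ b then 1 else 0

δ-refl : ∀ a → δ a a ≡ 1
δ-refl zero    = refl
δ-refl (suc a) = δ-refl a

δ-≢ : ∀ {a b} → a ≢ b → δ a b ≡ 0
δ-≢ {a} {b} a≢b with a ≡ᵇ b in a≡ᵇb
... | true  = ⊥-elim (a≢b (≡ᵇ⇒≡ a b (subst T (sym a≡ᵇb) tt)))
... | false = refl

isEntry12 : ℕ → Tableau → ℕ
isEntry12 k T = if does (entry12? T k) then 1 else 0

Counts-CountedByF : ∀ n k → Counts (CountedByF n k) (∑[ T ∈ tableaux n ] isEntry12 k T)
Counts-CountedByF n k =
  filter (λ T → entry12? T k) (tableaux n) ,
  Unique.filter⁺ (λ T → entry12? T k) (tableaux-unique n) ,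
  (λ T → mk⇔ (λ T∈ → let (T∈′ , e) = ∈-filter⁻ (λ T → entry12? T k) T∈ in tableaux-sound n T∈′ , e)
             (λ (syt , e) → ∈-filter⁺ (λ T → entry12? T k) (tableaux-complete n T syt) e)) ,
  length-filter (λ T → entry12? T k) (tableaux n)

Starts : ℕ → ℕ → Tableau → Set
Starts x y T = Σ (List ℕ) λ rest → Σ Tableau λ rows → T ≡ (x ∷ y ∷ rest) ∷ rows

Starts-placeWithin : ∀ {x y} h T z → Starts x y T → All (Starts x y) (placeWithin h T z)
Starts-placeWithin {x} {y} h _ z (rest , rows , refl) = Allₚ.++⁺
  (All-singletonIf (length (x ∷ y ∷ rest) <ᵇ h) (λ _ → rest ++ z ∷ [] , rows , refl))
  (Allₚ.map⁺ (All.universal (λ T → rest , T , refl) (placeWithin (length (x ∷ y ∷ rest)) rows z)))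

Starts-extensions : ∀ {x y} T c m → Starts x y T → All (Starts x y) (extensions T c m)
Starts-extensions T c zero    starts = starts ∷ []
Starts-extensions T c (suc m) starts = Allₚ.concat⁺ (Allₚ.map⁺ (All.tabulate λ {T′} T′∈ →
  Starts-extensions T′ (suc c) m (All.lookup (Starts-placeWithin _ T (suc c) starts) T′∈)))

isEntry12-Starts : ∀ {x y} k T → Starts x y T → isEntry12 k T ≡ δ y k
isEntry12-Starts k _ (_ , _ , refl) = refl

∑-extensions-Starts : ∀ {x y} k T c m → Starts x y T →
  ∑[ T′ ∈ extensions T c m ] isEntry12 k T′ ≡ δ y k * upPaths (shape T) m
∑-extensions-Starts {y = y} k T c m starts = begin
    ∑[ T′ ∈ extensions T c m ] isEntry12 k T′
  ≡⟨ ∑-cong-local (Starts-extensions T c m starts) (λ {T′} starts′ → trans (isEntry12-Starts k T′ starts′) (sym (*-identityʳ _))) ⟩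
    ∑[ T′ ∈ extensions T c m ] (δ y k * 1)
  ≡⟨ ∑-*ˡ (extensions T c m) (δ y k) (λ _ → 1) ⟩
    δ y k * ∑[ T′ ∈ extensions T c m ] 1
  ≡⟨ cong (δ y k *_) (∑-extensions-1 T c m) ⟩
    δ y k * upPaths (shape T) m
  ∎
  where open ≡-Reasoning

column : List ℕ → Tableau
column = map (_∷ [])

hook : ℕ → Shape
hook j = 2 ∷ replicate j 1

placeWithin-column : ∀ ys z → placeWithin 1 (column ys) z ≡ column (ys ++ z ∷ []) ∷ []
placeWithin-column []       z = refl
placeWithin-column (y ∷ ys) z = cong (map ((y ∷ []) ∷_)) (placeWithin-column ys z)

shape-column : ∀ ys → shape (column ys) ≡ replicate (length ys) 1
shape-column []       = refl
shape-column (_ ∷ ys) = cong (1 ∷_) (shape-column ys)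

module _ (k : ℕ) where

  -- In a single-column tableau the next entry goes either to position (1,2) or below the column.
  ∑-extensions-column-∷ : ∀ y ys c m → ∑[ T ∈ extensions (column (y ∷ ys)) c (suc m) ] isEntry12 k T ≡
    δ (suc c) k * upPaths (hook (length ys)) m + ∑[ T ∈ extensions (column (y ∷ ys ++ suc c ∷ [])) (suc c) m ] isEntry12 k T
  ∑-extensions-column-∷ y ys c m = begin
      ∑[ T ∈ extensions (column (y ∷ ys)) c (suc m) ] isEntry12 k T
    ≡⟨ ∑-concatMap (λ T′ → extensions T′ (suc c) m) (place (column (y ∷ ys)) (suc c)) _ ⟩
      ∑[ T′ ∈ place (column (y ∷ ys)) (suc c) ] ∑[ T ∈ extensions T′ (suc c) m ] isEntry12 k T
    ≡⟨ cong (λ Ts → ∑[ T′ ∈ first ∷ map ((y ∷ []) ∷_) Ts ] ∑[ T ∈ extensions T′ (suc c) m ] isEntry12 k T)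
            (placeWithin-column ys (suc c)) ⟩
      ∑[ T ∈ extensions first (suc c) m ] isEntry12 k T + (∑[ T ∈ extensions (column (y ∷ ys ++ suc c ∷ [])) (suc c) m ] isEntry12 k T + 0)
    ≡⟨ cong₂ _+_ (trans (∑-extensions-Starts k first (suc c) m ([] , column ys , refl))
                        (cong (λ μ → δ (suc c) k * upPaths (2 ∷ μ) m) (shape-column ys)))
                 (+-identityʳ _) ⟩
      δ (suc c) k * upPaths (hook (length ys)) m + ∑[ T ∈ extensions (column (y ∷ ys ++ suc c ∷ [])) (suc c) m ] isEntry12 k T
    ∎
    where
    open ≡-Reasoning
    first = (y ∷ suc c ∷ []) ∷ column ys

  ∑-extensions-column-late : ∀ y ys c m → k ≤ c → ∑[ T ∈ extensions (column (y ∷ ys)) c m ] isEntry12 k T ≡ 0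
  ∑-extensions-column-late y ys c zero    k≤c = refl
  ∑-extensions-column-late y ys c (suc m) k≤c = begin
      ∑[ T ∈ extensions (column (y ∷ ys)) c (suc m) ] isEntry12 k T
    ≡⟨ ∑-extensions-column-∷ y ys c m ⟩
      δ (suc c) k * upPaths (hook (length ys)) m + ∑[ T ∈ extensions (column (y ∷ ys ++ suc c ∷ [])) (suc c) m ] isEntry12 k T
    ≡⟨ cong₂ _+_ (cong (_* upPaths (hook (length ys)) m) (δ-≢ (λ 1+c≡k → <-irrefl (sym 1+c≡k) (s≤s k≤c))))
                 (∑-extensions-column-late y (ys ++ suc c ∷ []) (suc c) m (m≤n⇒m≤1+n k≤c)) ⟩
      0
    ∎
    where open ≡-Reasoning

  ∑-extensions-column : ∀ y ys c d m → k ≡ suc c + d →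
    ∑[ T ∈ extensions (column (y ∷ ys)) c (suc d + m) ] isEntry12 k T ≡ upPaths (hook (length ys + d)) m
  ∑-extensions-column y ys c zero m k≡ = begin
      ∑[ T ∈ extensions (column (y ∷ ys)) c (suc m) ] isEntry12 k T
    ≡⟨ ∑-extensions-column-∷ y ys c m ⟩
      δ (suc c) k * upPaths (hook (length ys)) m + ∑[ T ∈ extensions (column (y ∷ ys ++ suc c ∷ [])) (suc c) m ] isEntry12 k T
    ≡⟨ cong₂ _+_ (cong (_* upPaths (hook (length ys)) m) (trans (cong (δ (suc c)) k≡′) (δ-refl (suc c))))
                 (∑-extensions-column-late y (ys ++ suc c ∷ []) (suc c) m (≤-reflexive k≡′)) ⟩
      1 * upPaths (hook (length ys)) m + 0
    ≡⟨ trans (+-identityʳ _) (trans (*-identityˡ _) (cong (λ j → upPaths (hook j) m) (sym (+-identityʳ (length ys))))) ⟩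
      upPaths (hook (length ys + 0)) m
    ∎
    where
    open ≡-Reasoning
    k≡′ : k ≡ suc c
    k≡′ = trans k≡ (+-identityʳ (suc c))
  ∑-extensions-column y ys c (suc d) m k≡ = begin
      ∑[ T ∈ extensions (column (y ∷ ys)) c (suc (suc d + m)) ] isEntry12 k T
    ≡⟨ ∑-extensions-column-∷ y ys c (suc d + m) ⟩
      δ (suc c) k * upPaths (hook (length ys)) (suc d + m) + rest
    ≡⟨ cong (λ δ′ → δ′ * upPaths (hook (length ys)) (suc d + m) + rest) (δ-≢ 1+c≢k) ⟩
      rest
    ≡⟨ ∑-extensions-column y (ys ++ suc c ∷ []) (suc c) d m (trans k≡ (+-suc (suc c) d)) ⟩
      upPaths (hook (length (ys ++ suc c ∷ []) + d)) m
    ≡⟨ cong (λ j → upPaths (hook j) m) (trans (cong (_+ d) (length-∷ʳ ys (suc c))) (sym (+-suc (length ys) d))) ⟩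
      upPaths (hook (length ys + suc d)) m
    ∎
    where
    open ≡-Reasoning
    rest = ∑[ T ∈ extensions (column (y ∷ ys ++ suc c ∷ [])) (suc c) (suc d + m) ] isEntry12 k T
    1+c≢k : suc c ≢ k
    1+c≢k 1+c≡k = m≢1+m+n (suc c) (trans 1+c≡k (trans k≡ (cong suc (+-suc c d))))

  ∑-tableaux-isEntry12 : ∀ n → ∑[ T ∈ tableaux (suc n) ] isEntry12 k T ≡ ∑[ T ∈ extensions ((1 ∷ []) ∷ []) 1 n ] isEntry12 k T
  ∑-tableaux-isEntry12 n = trans (∑-tableaux-+ (isEntry12 k) 0 (suc n))
    (trans (+-identityʳ _) (cong (λ Ts → ∑ Ts (isEntry12 k)) (++-identityʳ (extensions ((1 ∷ []) ∷ []) 1 n))))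

-- Hooks

IsShape-column : ∀ j → IsShape (replicate j 1)
IsShape-column zero          = tt
IsShape-column (suc zero)    = s≤s z≤n , z≤n , tt
IsShape-column (suc (suc j)) = s≤s z≤n , s≤s z≤n , IsShape-column (suc j)

IsShape-hook : ∀ j → IsShape (hook j)
IsShape-hook zero    = s≤s z≤n , z≤n , tt
IsShape-hook (suc j) = s≤s z≤n , s≤s z≤n , IsShape-column (suc j)

down-column : ∀ j → down (replicate (suc j) 1) ≡ replicate j 1 ∷ []
down-column zero    = refl
down-column (suc j) = cong (map (1 ∷_)) (down-column j)

downPaths-column : ∀ j i → i ≤ j → downPaths (replicate j 1) i ≡ 1
downPaths-column j       zero    _         = refl
downPaths-column (suc j) (suc i) (s≤s i≤j) =
  trans (cong (λ ρs → ∑[ ρ ∈ ρs ] downPaths ρ i) (down-column j)) (trans (+-identityʳ _) (downPaths-column j i i≤j))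

downPaths-column-over : ∀ j i → j < i → downPaths (replicate j 1) i ≡ 0
downPaths-column-over zero    (suc i) _         = refl
downPaths-column-over (suc j) (suc i) (s≤s j<i) =
  trans (cong (λ ρs → ∑[ ρ ∈ ρs ] downPaths ρ i) (down-column j)) (trans (+-identityʳ _) (downPaths-column-over j i j<i))

downPaths-hook-suc : ∀ j i → downPaths (hook (suc j)) (suc i) ≡ downPaths (replicate (suc (suc j)) 1) i + downPaths (hook j) i
downPaths-hook-suc j i = cong (downPaths (replicate (suc (suc j)) 1) i +_)
  (trans (cong (λ ρs → ∑[ ρ ∈ map (2 ∷_) ρs ] downPaths ρ i) (down-column j)) (+-identityʳ _))

downPaths-hook : ∀ j i → i ≤ suc (suc j) → downPaths (hook j) i ≡ suc (i ⊓ j)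
downPaths-hook j       zero    _         = refl
downPaths-hook zero    (suc i) (s≤s i≤1) = trans (+-identityʳ _) (downPaths-column 1 i i≤1)
downPaths-hook (suc j) (suc i) (s≤s i≤) = trans (downPaths-hook-suc j i)
  (cong₂ _+_ (downPaths-column (suc (suc j)) i i≤) (downPaths-hook j i i≤))

downPaths-hook-over : ∀ j i → suc (suc j) < i → downPaths (hook j) i ≡ 0
downPaths-hook-over zero    (suc i) (s≤s 1<i) = trans (+-identityʳ _) (downPaths-column-over 1 i 1<i)
downPaths-hook-over (suc j) (suc i) (s≤s 2+j<i) = trans (downPaths-hook-suc j i)
  (cong₂ _+_ (downPaths-column-over (suc (suc j)) i 2+j<i) (downPaths-hook-over j i 2+j<i))

upPaths-hook : ∀ j m → upPaths (hook j) m ≡ ∑[ i < 3 + j ] (suc (i ⊓ j) * coeff m i)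
upPaths-hook j m = begin
    upPaths (hook j) m
  ≡⟨ upPaths-expansion m (hook j) (IsShape-hook j) ⟩
    ∑< (suc m) term
  ≡⟨ sym (∑<-pad (suc m) (3 + j) term (λ i m<i → trans (cong (downPaths (hook j) i *_) (coeff-above m i m<i)) (*-zeroʳ (downPaths (hook j) i)))) ⟩
    ∑< (suc m + (3 + j)) term
  ≡⟨ cong (λ N → ∑< N term) (+-comm (suc m) (3 + j)) ⟩
    ∑< (3 + j + suc m) term
  ≡⟨ ∑<-pad (3 + j) (suc m) term (λ i 3+j≤i → cong (_* coeff m i) (downPaths-hook-over j i 3+j≤i)) ⟩
    ∑< (3 + j) term
  ≡⟨ ∑<-cong (3 + j) (λ i i<3+j → cong (_* coeff m i) (downPaths-hook j i (≤-pred i<3+j))) ⟩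
    ∑[ i < 3 + j ] (suc (i ⊓ j) * coeff m i)
  ∎
  where
  open ≡-Reasoning
  term : ℕ → ℕ
  term i = downPaths (hook j) i * coeff m i

∑-hook-weights : ∀ j g → ∑[ i < 3 + j ] (suc (i ⊓ j) * g i) + g (suc j) + g (suc (suc j)) ≡ ∑[ i < 2 + j ] (g i + suc i * g (suc i))
∑-hook-weights j g = begin
    ∑[ i < 3 + j ] (suc (i ⊓ j) * g i) + x + y
  ≡⟨ cong (λ s → s + x + y) (trans (∑<-suc (2 + j) w) (cong (_+ suc (suc (suc j) ⊓ j) * y) (∑<-suc (1 + j) w))) ⟩
    ∑[ i < 1 + j ] (suc (i ⊓ j) * g i) + suc (suc j ⊓ j) * x + suc (suc (suc j) ⊓ j) * y + x + y
  ≡⟨ cong₂ (λ s w → s + suc w * x + suc (suc (suc j) ⊓ j) * y + x + y)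
       (∑<-cong (1 + j) (λ i i<1+j → cong (λ w → suc w * g i) (m≤n⇒m⊓n≡m (≤-pred i<1+j)))) (m≥n⇒m⊓n≡n (n≤1+n j)) ⟩
    A + suc j * x + suc (suc (suc j) ⊓ j) * y + x + y
  ≡⟨ cong (λ w → A + suc j * x + suc w * y + x + y) (m≥n⇒m⊓n≡n (≤-trans (n≤1+n j) (n≤1+n (suc j)))) ⟩
    A + suc j * x + suc j * y + x + y
  ≡⟨ solve 4 (λ A x y j → A :+ (con 1 :+ j) :* x :+ (con 1 :+ j) :* y :+ x :+ y := A :+ (con 2 :+ j) :* x :+ (con 2 :+ j) :* y) refl A x y j ⟩
    A + suc (suc j) * x + suc (suc j) * y
  ≡⟨ cong (_+ suc (suc j) * y) (sym (∑<-suc (1 + j) (λ i → suc i * g i))) ⟩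
    ∑[ i < 2 + j ] (suc i * g i) + suc (suc j) * y
  ≡⟨ cong (_+ suc (suc j) * y) (∑<-distrib-+ (2 + j) g (λ i → i * g i)) ⟩
    ∑< (2 + j) g + ∑[ i < 2 + j ] (i * g i) + suc (suc j) * y
  ≡⟨ +-assoc (∑< (2 + j) g) _ _ ⟩
    ∑< (2 + j) g + (∑[ i < 2 + j ] (i * g i) + suc (suc j) * y)
  ≡⟨ cong (∑< (2 + j) g +_) (sym (∑<-suc (2 + j) (λ i → i * g i))) ⟩
    ∑< (2 + j) g + ∑[ i < 3 + j ] (i * g i)
  ≡⟨ sym (∑<-distrib-+ (2 + j) g (λ i → suc i * g (suc i))) ⟩
    ∑[ i < 2 + j ] (g i + suc i * g (suc i))
  ∎
  where
  open ≡-Reasoning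
  open +-*-Solver
  x = g (suc j)
  y = g (suc (suc j))
  A = ∑[ i < 1 + j ] (suc i * g i)
  w : ℕ → ℕ
  w i = suc (i ⊓ j) * g i

∑-tableaux-isEntry12-formula : ∀ k m → 1 ≤ k →
  ∑[ T ∈ tableaux (k + m) ] isEntry12 k T + coeff m (k ∸ 1) + coeff m k ≡ ∑[ i < k ] ((m C i) * telephone (suc m ∸ i))
∑-tableaux-isEntry12-formula (suc zero) m _ = begin
    ∑[ T ∈ tableaux (suc m) ] isEntry12 1 T + coeff m 0 + coeff m 1
  ≡⟨ cong (λ f → f + coeff m 0 + coeff m 1) (trans (∑-tableaux-isEntry12 1 m) (∑-extensions-column-late 1 1 [] 1 m ≤-refl)) ⟩
    coeff m 0 + coeff m 1
  ≡⟨ cong (coeff m 0 +_) (sym (*-identityˡ (coeff m 1))) ⟩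
    coeff m 0 + 1 * coeff m 1
  ≡⟨ sym (trans (+-identityʳ _) (C*telephone-suc m 0)) ⟩
    ∑[ i < 1 ] ((m C i) * telephone (suc m ∸ i))
  ∎
  where open ≡-Reasoning
∑-tableaux-isEntry12-formula (suc (suc j)) m _ = begin
    ∑[ T ∈ tableaux (suc (suc j) + m) ] isEntry12 k T + coeff m (suc j) + coeff m k
  ≡⟨ cong (λ f → f + coeff m (suc j) + coeff m k) (trans (∑-tableaux-isEntry12 k (suc j + m)) (∑-extensions-column k 1 [] 1 j m refl)) ⟩
    upPaths (hook j) m + coeff m (suc j) + coeff m k
  ≡⟨ cong (λ f → f + coeff m (suc j) + coeff m k) (upPaths-hook j m) ⟩
    ∑[ i < 3 + j ] (suc (i ⊓ j) * coeff m i) + coeff m (suc j) + coeff m k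
  ≡⟨ ∑-hook-weights j (coeff m) ⟩
    ∑[ i < k ] (coeff m i + suc i * coeff m (suc i))
  ≡⟨ ∑<-cong k (λ i _ → sym (C*telephone-suc m i)) ⟩
    ∑[ i < k ] ((m C i) * telephone (suc m ∸ i))
  ∎
  where
  open ≡-Reasoning
  k = suc (suc j)

-- Imported only here: the constructor +_ would make the sections (x +_) above ambiguous.
open import Data.Integer as ℤ using (ℤ; +_)
import Data.Integer.Properties as ℤₚ
import Data.Integer.Solver as ℤSolver

+[m∸n]≡+m-+n : ∀ {a b} → b ≤ a → + (a ∸ b) ≡ + a ℤ.- + b
+[m∸n]≡+m-+n {a} {b} b≤a = sym (trans (ℤₚ.m-n≡m⊖n a b) (ℤₚ.⊖-≥ b≤a))

sumTo-∑< : ∀ k (g : ℕ → ℤ) h → (∀ j → j < k → g j ≡ + h j) → sumTo k g ≡ + ∑< k h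
sumTo-∑< k g h g≡h = go k (λ j → j) h g≡h
  where
  go : ∀ k (f : ℕ → ℕ) h → (∀ j → j < k → g (f j) ≡ + h j) → foldr ℤ._+_ (+ 0) (map g (applyUpTo f k)) ≡ + ∑< k h
  go zero    f h _    = refl
  go (suc k) f h g≡h = cong₂ ℤ._+_ (g≡h 0 (s≤s z≤n)) (go k (f ∘ suc) (h ∘ suc) (λ j j<k → g≡h (suc j) (s≤s j<k)))

+[k+m]-+[2k]≡+m-+k : ∀ k m → + (k + m) ℤ.- + (2 * k) ≡ + m ℤ.- + k
+[k+m]-+[2k]≡+m-+k k m = begin
    + (k + m) ℤ.- + (2 * k)        ≡⟨ cong₂ ℤ._-_ (ℤₚ.pos-+ k m) (ℤₚ.pos-* 2 k) ⟩
    (+ k ℤ.+ + m) ℤ.- + 2 ℤ.* + k   ≡⟨ solve 2 (λ K M → (K :+ M) :- con (+ 2) :* K := M :- K) refl (+ k) (+ m) ⟩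
    + m ℤ.- + k                     ∎
  where
  open ≡-Reasoning
  open ℤSolver.+-*-Solver

module _ (t : ℕ → ℕ) (t≗telephone : ∀ m → t m ≡ telephone m) where

  Cℤ*tℤ : ∀ m i z a → (i ≤ m → z ≡ + a) → Cℤ m i ℤ.* tℤ t z ≡ + ((m C i) * telephone a)
  Cℤ*tℤ m i z a z≡a with i ≤? m
  ... | yes i≤m rewrite z≡a i≤m | t≗telephone a = sym (ℤₚ.pos-* (m C i) (telephone a))
  ... | no i≰m  rewrite k>n⇒nCk≡0 (≰⇒> i≰m) = refl

  -- With i = k−1−j the j-th summand of RHS is C(m,i) t(m+1−i); t is taken at a
  -- negative index only where C(m,i) = 0.
  RHS-expansion : ∀ k m → 1 ≤ k →
    RHS t (k + m) k ≡ + ∑[ i < k ] ((m C i) * telephone (suc m ∸ i)) ℤ.- + coeff m (k ∸ 1) ℤ.- + coeff m k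
  RHS-expansion k m 1≤k rewrite m+n∸m≡n k m = cong₂ ℤ._-_ (cong₂ ℤ._-_ summands second) third
    where
    open ℤSolver.+-*-Solver
    U : ℕ → ℕ
    U i = (m C i) * telephone (suc m ∸ i)
    summand : ∀ j → j < k → Cℤ m (k ∸ j ∸ 1) ℤ.* tℤ t (+ (k + m) ℤ.- + (2 * k) ℤ.+ + j ℤ.+ + 2) ≡ + U (k ∸ suc j)
    summand j j<k rewrite ∸-+-assoc k j 1 | +-comm j 1 = Cℤ*tℤ m (k ∸ suc j) _ _ λ i≤m → begin
        + (k + m) ℤ.- + (2 * k) ℤ.+ + j ℤ.+ + 2
      ≡⟨ cong (λ x → x ℤ.+ + j ℤ.+ + 2) (+[k+m]-+[2k]≡+m-+k k m) ⟩
        + m ℤ.- + k ℤ.+ + j ℤ.+ + 2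
      ≡⟨ solve 3 (λ M K J → M :- K :+ J :+ con (+ 2) := (con (+ 1) :+ M) :- (K :- (con (+ 1) :+ J))) refl (+ m) (+ k) (+ j) ⟩
        + suc m ℤ.- (+ k ℤ.- + suc j)
      ≡⟨ sym (trans (+[m∸n]≡+m-+n (m≤n⇒m≤1+n i≤m)) (cong (λ y → + suc m ℤ.- y) (+[m∸n]≡+m-+n j<k))) ⟩
        + (suc m ∸ (k ∸ suc j))
      ∎
      where open ≡-Reasoning
    summands : sumTo k (λ j → Cℤ m (k ∸ j ∸ 1) ℤ.* tℤ t (+ (k + m) ℤ.- + (2 * k) ℤ.+ + j ℤ.+ + 2)) ≡ + ∑< k U
    summands = trans (sumTo-∑< k _ (λ j → U (k ∸ suc j)) summand) (cong +_ (∑<-reverse k U))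
    second : Cℤ m (k ∸ 1) ℤ.* tℤ t (+ (k + m) ℤ.- + (2 * k) ℤ.+ + 1) ≡ + coeff m (k ∸ 1)
    second = Cℤ*tℤ m (k ∸ 1) _ _ λ k-1≤m → trans (cong (ℤ._+ + 1) (+[k+m]-+[2k]≡+m-+k k m))
      (trans (solve 2 (λ M K → M :- K :+ con (+ 1) := M :- (K :- con (+ 1))) refl (+ m) (+ k))
             (sym (trans (+[m∸n]≡+m-+n k-1≤m) (cong (λ y → + m ℤ.- y) (+[m∸n]≡+m-+n 1≤k)))))
    third : Cℤ m k ℤ.* tℤ t (+ (k + m) ℤ.- + (2 * k)) ≡ + coeff m k
    third = Cℤ*tℤ m k _ _ λ k≤m → trans (+[k+m]-+[2k]≡+m-+k k m) (sym (+[m∸n]≡+m-+n k≤m))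

+-sub-sub : ∀ f a b s → f + a + b ≡ s → + f ≡ + s ℤ.- + a ℤ.- + b
+-sub-sub f a b _ refl = solve 3 (λ F A B → F := (F :+ A :+ B) :- A :- B) refl (+ f) (+ a) (+ b)
  where open ℤSolver.+-*-Solver

theorem3 : (t : ℕ → ℕ) → (∀ m → Counts (IsInvolution m) (t m)) →
    ∀ n k → 1 ≤ k → k ≤ n →
    Σ ℕ λ f → Counts (CountedByF n k) f × (+ f ≡ RHS t n k)
theorem3 t t-counts n k 1≤k k≤n =
  ∑[ T ∈ tableaux n ] isEntry12 k T , Counts-CountedByF n k ,
  subst (λ n′ → + ∑[ T ∈ tableaux n′ ] isEntry12 k T ≡ RHS t n′ k) (m+[n∸m]≡n k≤n)
    (trans (+-sub-sub _ _ _ _ (∑-tableaux-isEntry12-formula k (n ∸ k) 1≤k)) (sym (RHS-expansion t t≗telephone k (n ∸ k) 1≤k)))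
  where
  t≗telephone : ∀ m → t m ≡ telephone m
  t≗telephone m = Counts-unique (t-counts m) (Counts-involution m)
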